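{- Let $a_1,a_2,b_1,b_2$ be integers with $a_1,a_2$ positive. Suppose that either (A) $-a_1 \leq b_1 \leq 0$ and $-a_2 \leq b_2 \leq 0$, or (B) $b_1 \geq 0$ and $b_2 \geq 0$. Then every $(a_1+a_2,\, b_1+b_2)$-sparse graph $G$ admits a partition $E(G) = E(G_1) \cup E(G_2)$ (with $E(G_1)\cap E(G_2)=\emptyset$, $G_1,G_2$ subgraphs of $G$) such that $G_1$ is $(a_1,b_1)$-sparse and $G_2$ is $(a_2,b_2)$-sparse.
   Context: All graphs are finite and simple. For a graph $H$, $v(H)$ and $e(H)$ denote its numbers of vertices and edges. For $a \in \mathbb{R}_{>0}$ and $b \in \mathbb{R}$, a graph $G$ is $(a,b)$-sparse if every nonempty subgraph $H$ of $G$ satisfies $e(H) \leq a\, v(H) + b$. -}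

module Defs where

open import Data.Nat using (ℕ; _<_)
open import Data.Integer using (ℤ; +_; _+_; _*_; _≤_)
open import Data.Fin using (Fin; zero; suc)
open import Data.Fin.Subset using (Subset; _∈_; _⊆_; Nonempty; ∣_∣)
open import Data.Product using (_×_; _,_; proj₁; proj₂; Σ)
open import Data.List using (List; []; _∷_; length; lookup)
open import Data.List.Relation.Unary.All using (All)
open import Data.List.Relation.Unary.Unique.Propositional using (Unique)
open import Data.Bool using (Bool; true; false; _≟_)
open import Relation.Binary.PropositionalEquality using (_≡_)
open import Relation.Nullary using (yes; no)

-- An edge on vertex set Fin n, stored as an ordered pair (u , v) with u < v.
Edge : ℕ → Set
Edge n = Fin n × Fin n

-- A finite simple graph with vertex set Fin n: a duplicate-free list of
-- edges {u,v} with u < v (so no loops, no multi-edges).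
record Graph (n : ℕ) : Set where
  field
    edges   : List (Edge n)
    ordered : All (λ e → Data.Fin._<_ (proj₁ e) (proj₂ e)) edges
    unique  : Unique edges
open Graph public

record Subgraph {n : ℕ} (E : List (Edge n)) : Set where
  field
    verts    : Subset n
    edgeSet  : Subset (length E)
    closed   : ∀ i → i ∈ edgeSet →
               proj₁ (lookup E i) ∈ verts × proj₂ (lookup E i) ∈ verts
open Subgraph public

vH : ∀ {n} {E : List (Edge n)} → Subgraph E → ℕ
vH H = ∣ verts H ∣

eH : ∀ {n} {E : List (Edge n)} → Subgraph E → ℕ
eH H = ∣ edgeSet H ∣

-- The graph with vertex set Fin n and edge list E is (a,b)-sparse:
-- every nonempty subgraph H (i.e. with at least one vertex) satisfies
-- e(H) ≤ a v(H) + b.  (a > 0 is imposed where used.)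
SparseEdges : ∀ {n} → ℤ → ℤ → List (Edge n) → Set
SparseEdges a b E = (H : Subgraph E) → Nonempty (verts H) →
  + eH H ≤ a * + vH H + b

Sparse : ∀ {n} → ℤ → ℤ → Graph n → Set
Sparse a b G = SparseEdges a b (edges G)

colourClass : ∀ {n} (E : List (Edge n)) → (Fin (length E) → Bool) → Bool → List (Edge n)
colourClass []      c β = []
colourClass (e ∷ E) c β with c zero ≟ β
... | yes _ = e ∷ colourClass E (λ i → c (suc i)) β
... | no  _ = colourClass E (λ i → c (suc i)) β

-- For each colour d, the edge sets F with e_F(W) ≤ a_d |W| + b_d for every nonempty vertex set W
-- form a count matroid, and the claim is that E(G) is independent in the union of the two.
-- Edges are coloured one at a time by the augmenting-path algorithm for matroid union: a
-- breadth-first search in the exchange graph from an uncoloured edge e either reaches an edge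
-- that one colour class can absorb, and recolouring along a shortest such path colours e, or it
-- gets stuck in a set S ∋ e of reachable edges. Then every edge of S lies in a tight set of each
-- colour class restricted to S, and the greatest tight sets cover S by disjoint tight sets, once
-- for each colour. Summing the sparsity of G over the cells P ∩ Q of the two covers (when b ≤ 0)
-- or over the intersection of their unions (when b ≥ 0) gives |S| ≤ |S ∩ class true| +
-- |S ∩ class false|, which is impossible since e ∈ S is uncoloured.

module Submission where

import Algebra.Properties.CommutativeMonoid.Sum as Summation
open import Data.Bool using (Bool; true; false; _∧_; _∨_; not; if_then_else_) renaming (_≟_ to _≟ᵇ_)
open import Data.Bool.Properties using (¬-not; ∧-zeroʳ; ∨-identityʳ; ∧-assoc; ∧-comm)
open import Data.Empty using (⊥; ⊥-elim)
open import Data.Fin using (Fin; zero; suc; punchIn)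
open import Data.Fin.Properties using (punchInᵢ≢i; any?; all?; ¬∀⟶∃¬) renaming (_≟_ to _≟ᶠ_)
import Data.Fin.Subset as Subset
open import Data.Fin.Subset.Properties using (anySubset?)
open import Data.Integer as ℤ using (ℤ; +_; -_; _+_; _*_; _≤_; _<_)
import Data.Integer.Properties as ℤ
open import Data.Integer.Tactic.RingSolver using (solve-∀)
open import Data.List using (List; []; _∷_; length) renaming (lookup to entry)
open import Data.Maybe using (Maybe; just; nothing; is-just)
open import Data.Maybe.Properties using (just-injective) renaming (≡-dec to ≡-decₘ)
open import Data.Nat as ℕ using (ℕ; zero; suc; z≤n; s≤s)
import Data.Nat.Properties as ℕ
open import Data.Nat.Induction using (<-wellFounded)
open import Data.Product using (Σ; ∃; _×_; _,_; proj₁; proj₂)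
open import Data.Sum as Sum using (_⊎_; inj₁; inj₂; [_,_]′)
open import Data.Vec using ([]; _∷_; here; there; lookup; tabulate)
import Data.Vec.Functional as Vector
open import Data.Vec.Properties using ([]=⇒lookup; lookup⇒[]=; lookup∘tabulate)
open import Function using (_∘_; case_of_)
open import Induction.WellFounded using (Acc; acc)
open import Relation.Binary.PropositionalEquality
open import Relation.Nullary using (Dec; yes; no; ¬_; does)
import Relation.Nullary.Decidable as Dec
open import Relation.Unary using (Decidable)

open import Defs

module ℕΣ = Summation ℕ.+-0-commutativeMonoid
module ℤΣ = Summation ℤ.+-0-commutativeMonoid

𝒫 : ℕ → Set
𝒫 k = Fin k → Bool

module _ {k : ℕ} where

  infixr 7 _∩_
  infixr 6 _∪_
  infix 4 _⊆_

  _∩_ _∪_ : 𝒫 k → 𝒫 k → 𝒫 k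
  (V ∩ W) i = V i ∧ W i
  (V ∪ W) i = V i ∨ W i

  ∁ : 𝒫 k → 𝒫 k
  ∁ W i = not (W i)

  insert remove : Fin k → 𝒫 k → 𝒫 k
  insert x W i = does (i ≟ᶠ x) ∨ W i
  remove x W i = not (does (i ≟ᶠ x)) ∧ W i

  _⊆_ : 𝒫 k → 𝒫 k → Set
  V ⊆ W = ∀ i → V i ≡ true → W i ≡ true

  Nonempty : 𝒫 k → Set
  Nonempty W = ∃ λ i → W i ≡ true

  nonempty? : (W : 𝒫 k) → Dec (Nonempty W)
  nonempty? W = any? (λ i → W i ≟ᵇ true)

  ⊆-trans : ∀ {U V W} → U ⊆ V → V ⊆ W → U ⊆ W
  ⊆-trans U⊆V V⊆W i h = V⊆W i (U⊆V i h)

  ⊆-false : ∀ {V W i} → V ⊆ W → W i ≡ false → V i ≡ false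
  ⊆-false {V} {i = i} V⊆W Wi with V i in Vi
  ... | false = refl
  ... | true  = trans (sym (V⊆W i Vi)) Wi

  ∩-⊆ˡ : ∀ V W → V ∩ W ⊆ V
  ∩-⊆ˡ V W i h with V i
  ... | true = refl

  ∩-⊆ʳ : ∀ V W → V ∩ W ⊆ W
  ∩-⊆ʳ V W i h with V i
  ... | true = h

  ⊆-∩ : ∀ {U V W} → U ⊆ V → U ⊆ W → U ⊆ V ∩ W
  ⊆-∩ U⊆V U⊆W i h rewrite U⊆V i h = U⊆W i h

  ⊆-∪ˡ : ∀ V W → V ⊆ V ∪ W
  ⊆-∪ˡ V W i h rewrite h = refl

  ⊆-∪ʳ : ∀ V W → W ⊆ V ∪ W
  ⊆-∪ʳ V W i h rewrite h with V i
  ... | true  = refl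
  ... | false = refl

  ∪-⊆ : ∀ {U V W} → V ⊆ U → W ⊆ U → V ∪ W ⊆ U
  ∪-⊆ {V = V} V⊆U W⊆U i h with V i in Vi
  ... | true  = V⊆U i Vi
  ... | false = W⊆U i h

  insert-here : ∀ x W → insert x W x ≡ true
  insert-here x W with x ≟ᶠ x
  ... | yes _  = refl
  ... | no x≢x = ⊥-elim (x≢x refl)

  insert-there : ∀ {x i} W → i ≢ x → insert x W i ≡ W i
  insert-there {x} {i} W i≢x with i ≟ᶠ x
  ... | yes i≡x = ⊥-elim (i≢x i≡x)
  ... | no _    = refl

  remove-here : ∀ x W → remove x W x ≡ false
  remove-here x W with x ≟ᶠ x
  ... | yes _  = refl
  ... | no x≢x = ⊥-elim (x≢x refl)

  remove-there : ∀ {x i} W → i ≢ x → remove x W i ≡ W i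
  remove-there {x} {i} W i≢x with i ≟ᶠ x
  ... | yes i≡x = ⊥-elim (i≢x i≡x)
  ... | no _    = refl

  ⊆-insert : ∀ x {W} → W ⊆ insert x W
  ⊆-insert x i Wi with i ≟ᶠ x
  ... | yes _ = refl
  ... | no _  = Wi

  insert-⊆ : ∀ {x V W} → V ⊆ W → W x ≡ true → insert x V ⊆ W
  insert-⊆ {x} V⊆W Wx i h with i ≟ᶠ x
  ... | yes refl = Wx
  ... | no _     = V⊆W i h

  remove-⊆ : ∀ x {W} → remove x W ⊆ W
  remove-⊆ x i h with i ≟ᶠ x
  ... | no _ = h

  insert-mono : ∀ x {V W} → V ⊆ W → insert x V ⊆ insert x W
  insert-mono x V⊆W i h with i ≟ᶠ x
  ... | yes _ = refl
  ... | no _  = V⊆W i h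

  remove-mono : ∀ x {V W} → V ⊆ W → remove x V ⊆ remove x W
  remove-mono x V⊆W i h with i ≟ᶠ x
  ... | no _ = V⊆W i h

  insert-cong : ∀ x {V W} → V ≗ W → insert x V ≗ insert x W
  insert-cong x V≗W i = cong (does (i ≟ᶠ x) ∨_) (V≗W i)

  remove-cong : ∀ x {V W} → V ≗ W → remove x V ≗ remove x W
  remove-cong x V≗W i = cong (not (does (i ≟ᶠ x)) ∧_) (V≗W i)

  insert-remove-comm : ∀ {x z} W → x ≢ z → insert x (remove z W) ≗ remove z (insert x W)
  insert-remove-comm {x} {z} W x≢z i with i ≟ᶠ x | i ≟ᶠ z
  ... | yes refl | yes refl = ⊥-elim (x≢z refl)
  ... | yes _    | no _     = refl
  ... | no _     | yes _    = refl
  ... | no _     | no _     = refl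

  ⋃ : ∀ {p} → (Fin p → 𝒫 k) → 𝒫 k
  ⋃ {zero}  P = λ _ → false
  ⋃ {suc p} P = P zero ∪ ⋃ (P ∘ suc)

  ⊆-⋃ : ∀ {p} (P : Fin p → 𝒫 k) j → P j ⊆ ⋃ P
  ⊆-⋃ P zero    = ⊆-∪ˡ (P zero) _
  ⊆-⋃ P (suc j) = ⊆-trans (⊆-⋃ (P ∘ suc) j) (⊆-∪ʳ (P zero) _)

true≢false : true ≢ false
true≢false ()

iverson : Bool → ℕ
iverson true  = 1
iverson false = 0

iverson≤1 : ∀ b → iverson b ℕ.≤ 1
iverson≤1 true  = s≤s z≤n
iverson≤1 false = z≤n

card : ∀ {k} → 𝒫 k → ℕ
card W = ℕΣ.sum (iverson ∘ W)

sum-mono : ∀ {k} {g h : Fin k → ℕ} → (∀ i → g i ℕ.≤ h i) → ℕΣ.sum g ℕ.≤ ℕΣ.sum h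
sum-mono {zero}  le = z≤n
sum-mono {suc k} le = ℕ.+-mono-≤ (le zero) (sum-mono (le ∘ suc))

ℤsum-mono : ∀ {k} {g h : Fin k → ℤ} → (∀ i → g i ≤ h i) → ℤΣ.sum g ≤ ℤΣ.sum h
ℤsum-mono {zero}  le = ℤ.≤-refl
ℤsum-mono {suc k} le = ℤ.+-mono-≤ (le zero) (ℤsum-mono (le ∘ suc))

+-sum : ∀ {k} (g : Fin k → ℕ) → + ℕΣ.sum g ≡ ℤΣ.sum (λ i → + g i)
+-sum {zero}  g = refl
+-sum {suc k} g = trans (ℤ.pos-+ (g zero) _) (cong (λ s → + g zero + s) (+-sum (g ∘ suc)))

sum-point : ∀ {k} (g : Fin k → ℕ) j → g j ℕ.≤ ℕΣ.sum g
sum-point {suc k} g j = subst (g j ℕ.≤_) (sym (ℕΣ.sum-remove {i = j} g)) (ℕ.m≤m+n (g j) _)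

+-squeeze : ∀ {x X y Y : ℤ} → x ≤ X → y ≤ Y → X + Y ≤ x + y → x ≡ X
+-squeeze x≤X y≤Y XY≤xy =
  ℤ.≤-antisym x≤X (ℤ.≮⇒≥ (λ x<X → ℤ.<⇒≱ (ℤ.+-mono-<-≤ x<X y≤Y) XY≤xy))

card-except : ∀ {k} x (V W : 𝒫 k) → (∀ i → i ≢ x → V i ≡ W i) →
              card V ℕ.+ iverson (W x) ≡ card W ℕ.+ iverson (V x)
card-except {suc k} x V W agree = begin
  card V ℕ.+ w                  ≡⟨ cong (ℕ._+ w) (ℕΣ.sum-remove {i = x} (iverson ∘ V)) ⟩
  v ℕ.+ rest V ℕ.+ w            ≡⟨ cong (λ r → v ℕ.+ r ℕ.+ w) rest-agree ⟩
  v ℕ.+ rest W ℕ.+ w            ≡⟨ swap v (rest W) w ⟩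
  w ℕ.+ rest W ℕ.+ v            ≡⟨ cong (ℕ._+ v) (ℕΣ.sum-remove {i = x} (iverson ∘ W)) ⟨
  card W ℕ.+ v                  ∎
  where
  open ≡-Reasoning
  v w : ℕ
  v = iverson (V x)
  w = iverson (W x)
  rest : 𝒫 (suc k) → ℕ
  rest U = ℕΣ.sum (λ j → iverson (U (punchIn x j)))
  rest-agree : rest V ≡ rest W
  rest-agree = ℕΣ.sum-cong-≗ (λ j → cong iverson (agree (punchIn x j) (punchInᵢ≢i x j)))
  swap : ∀ a b c → a ℕ.+ b ℕ.+ c ≡ c ℕ.+ b ℕ.+ a
  swap a b c = trans (ℕ.+-comm (a ℕ.+ b) c) (trans (cong (c ℕ.+_) (ℕ.+-comm a b)) (sym (ℕ.+-assoc c b a)))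

module _ {k : ℕ} where

  card-cong : ∀ {V W : 𝒫 k} → V ≗ W → card V ≡ card W
  card-cong V≗W = ℕΣ.sum-cong-≗ (cong iverson ∘ V≗W)

  card-mono : ∀ {V W : 𝒫 k} → V ⊆ W → card V ℕ.≤ card W
  card-mono {V} {W} V⊆W = sum-mono pointwise
    where
    pointwise : ∀ i → iverson (V i) ℕ.≤ iverson (W i)
    pointwise i with V i | V⊆W i
    ... | true  | Wi = ℕ.≤-reflexive (cong iverson (sym (Wi refl)))
    ... | false | _  = z≤n

  card-≤ : (W : 𝒫 k) → card W ℕ.≤ k
  card-≤ W = ℕ.≤-trans (sum-mono (iverson≤1 ∘ W)) (ℕ.≤-reflexive (ones k))
    where
    ones : ∀ k → ℕΣ.sum {k} (λ _ → 1) ≡ k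
    ones zero    = refl
    ones (suc k) = cong suc (ones k)

  card-insert : ∀ {x} {W : 𝒫 k} → W x ≡ false → card (insert x W) ≡ suc (card W)
  card-insert {x} {W} Wx = begin
    card (insert x W)                   ≡⟨ ℕ.+-identityʳ _ ⟨
    card (insert x W) ℕ.+ 0             ≡⟨ cong (λ b → card (insert x W) ℕ.+ iverson b) Wx ⟨
    card (insert x W) ℕ.+ iverson (W x) ≡⟨ card-except x (insert x W) W (λ i → insert-there W) ⟩
    card W ℕ.+ iverson (insert x W x)   ≡⟨ cong (λ b → card W ℕ.+ iverson b) (insert-here x W) ⟩
    card W ℕ.+ 1                        ≡⟨ ℕ.+-comm (card W) 1 ⟩
    suc (card W)                        ∎
    where open ≡-Reasoning

  card-< : ∀ {x} {V W : 𝒫 k} → V ⊆ W → V x ≡ false → W x ≡ true → card V ℕ.< card W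
  card-< {W = W} V⊆W Vx Wx = subst (ℕ._≤ card W) (card-insert Vx) (card-mono (insert-⊆ V⊆W Wx))

  card-pos : ∀ {W : 𝒫 k} → Nonempty W → 0 ℕ.< card W
  card-pos {W} (x , Wx) = subst (ℕ._< card W) (ℕΣ.sum-replicate-zero k) (card-< (λ _ ()) refl Wx)

  card-empty : ∀ {W : 𝒫 k} → ¬ Nonempty W → card W ≡ 0
  card-empty W=∅ = trans (card-cong (λ i → ¬-not (λ Wi → W=∅ (i , Wi)))) (ℕΣ.sum-replicate-zero k)

  card-nonempty : ∀ {W : 𝒫 k} → 0 ℕ.< card W → Nonempty W
  card-nonempty {W} 0<card with nonempty? W
  ... | yes W≠∅ = W≠∅
  ... | no  W=∅ = ⊥-elim (ℕ.<-irrefl (sym (card-empty W=∅)) 0<card)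

  card-∪∩ : (V W : 𝒫 k) → card (V ∪ W) ℕ.+ card (V ∩ W) ≡ card V ℕ.+ card W
  card-∪∩ V W = begin
    card (V ∪ W) ℕ.+ card (V ∩ W)
      ≡⟨ ℕΣ.∑-distrib-+ (iverson ∘ (V ∪ W)) (iverson ∘ (V ∩ W)) ⟨
    ℕΣ.sum (λ i → iverson ((V ∪ W) i) ℕ.+ iverson ((V ∩ W) i))
      ≡⟨ ℕΣ.sum-cong-≗ (λ i → pointwise (V i) (W i)) ⟩
    ℕΣ.sum (λ i → iverson (V i) ℕ.+ iverson (W i))
      ≡⟨ ℕΣ.∑-distrib-+ (iverson ∘ V) (iverson ∘ W) ⟩
    card V ℕ.+ card W ∎
    where
    open ≡-Reasoning
    pointwise : ∀ p q → iverson (p ∨ q) ℕ.+ iverson (p ∧ q) ≡ iverson p ℕ.+ iverson q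
    pointwise true  true  = refl
    pointwise true  false = refl
    pointwise false true  = refl
    pointwise false false = refl

module _ {k p : ℕ} (G : Fin p → 𝒫 k) where

  card-≤-cover : ∀ {S} → (∀ x → S x ≡ true → ∃ λ j → G j x ≡ true) →
                 card S ℕ.≤ ℕΣ.sum (λ j → card (S ∩ G j))
  card-≤-cover {S} covers = begin
    card S
      ≤⟨ sum-mono pointwise ⟩
    ℕΣ.sum (λ x → ℕΣ.sum (λ j → iverson (S x ∧ G j x)))
      ≡⟨ ℕΣ.∑-comm (λ x j → iverson (S x ∧ G j x)) ⟩
    ℕΣ.sum (λ j → card (S ∩ G j)) ∎
    where
    open ℕ.≤-Reasoning
    pointwise : ∀ x → iverson (S x) ℕ.≤ ℕΣ.sum (λ j → iverson (S x ∧ G j x))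
    pointwise x with S x in Sx
    ... | false = z≤n
    ... | true  = let (j , Gjx) = covers x Sx in
                  subst (λ b → iverson b ℕ.≤ ℕΣ.sum (λ j → iverson (G j x))) Gjx
                        (sum-point (λ j → iverson (G j x)) j)

  disjoint-card : (∀ x → ℕΣ.sum (λ j → iverson (G j x)) ℕ.≤ 1) →
                  ∀ X → ℕΣ.sum (λ j → card (X ∩ G j)) ℕ.≤ card X
  disjoint-card disjoint X = begin
    ℕΣ.sum (λ j → card (X ∩ G j))
      ≡⟨ ℕΣ.∑-comm (λ j x → iverson (X x ∧ G j x)) ⟩
    ℕΣ.sum (λ x → ℕΣ.sum (λ j → iverson (X x ∧ G j x)))
      ≤⟨ sum-mono pointwise ⟩
    card X ∎
    where
    open ℕ.≤-Reasoning
    pointwise : ∀ x → ℕΣ.sum (λ j → iverson (X x ∧ G j x)) ℕ.≤ iverson (X x)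
    pointwise x with X x
    ... | false = ℕ.≤-reflexive (ℕΣ.sum-replicate-zero p)
    ... | true  = disjoint x

module _ {k : ℕ} where

  Respects≗ : (𝒫 k → Set) → Set
  Respects≗ Q = ∀ {V W} → V ≗ W → Q V → Q W

  exists? : {Q : 𝒫 k → Set} → Decidable Q → Respects≗ Q → Dec (Σ (𝒫 k) Q)
  exists? Q? Q-resp =
    Dec.map′ (λ (v , q) → lookup v , q)
             (λ (W , q) → tabulate W , Q-resp (sym ∘ lookup∘tabulate W) q)
             (anySubset? (Q? ∘ lookup))

  argmin : {Q : 𝒫 k → Set} → Decidable Q → Respects≗ Q →
           (μ : 𝒫 k → ℕ) → (∀ {V W} → V ≗ W → μ V ≡ μ W) →
           ∀ {W₀} → Q W₀ → Σ (𝒫 k) λ W → Q W × (∀ V → Q V → μ W ℕ.≤ μ V)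
  argmin {Q} Q? Q-resp μ μ-resp {W₀} q₀ = descend W₀ q₀ (<-wellFounded (μ W₀))
    where
    descend : ∀ W → Q W → Acc ℕ._<_ (μ W) → Σ (𝒫 k) λ W → Q W × (∀ V → Q V → μ W ℕ.≤ μ V)
    descend W q (acc smaller) with exists? {λ V → Q V × μ V ℕ.< μ W}
      (λ V → Q? V Dec.×-dec (μ V ℕ.<? μ W))
      (λ V≗W (q , lt) → Q-resp V≗W q , subst (ℕ._< μ W) (μ-resp V≗W) lt)
    ... | yes (V , qV , lt) = descend V qV (smaller lt)
    ... | no none           = W , q , λ V qV → ℕ.≮⇒≥ (λ lt → none (V , qV , lt))

  minimum-card : {Q : 𝒫 k → Set} → Decidable Q → Respects≗ Q →
                 ∀ {W₀} → Q W₀ → Σ (𝒫 k) λ W → Q W × (∀ V → Q V → card W ℕ.≤ card V)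
  minimum-card Q? Q-resp = argmin Q? Q-resp card card-cong

  maximum-card : {Q : 𝒫 k → Set} → Decidable Q → Respects≗ Q →
                 ∀ {W₀} → Q W₀ → Σ (𝒫 k) λ W → Q W × (∀ V → Q V → card V ℕ.≤ card W)
  maximum-card Q? Q-resp q₀ with argmin Q? Q-resp (λ W → k ℕ.∸ card W) (cong (k ℕ.∸_) ∘ card-cong) q₀
  ... | W , q , least = W , q , λ V qV → begin
    card V               ≡⟨ ℕ.m∸[m∸n]≡n (card-≤ V) ⟨
    k ℕ.∸ (k ℕ.∸ card V) ≤⟨ ℕ.∸-monoʳ-≤ k (least V qV) ⟩
    k ℕ.∸ (k ℕ.∸ card W) ≡⟨ ℕ.m∸[m∸n]≡n (card-≤ W) ⟩
    card W               ∎
    where open ℕ.≤-Reasoning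

-- Edges spanned by a vertex set

module Edges {n m : ℕ} (ends : Fin m → Fin n × Fin n) where

  induced : 𝒫 n → 𝒫 m
  induced W i = W (proj₁ (ends i)) ∧ W (proj₂ (ends i))

  spanned : 𝒫 m → 𝒫 n → ℕ
  spanned F W = card (F ∩ induced W)

  induced-mono : ∀ {V W} → V ⊆ W → induced V ⊆ induced W
  induced-mono {V} V⊆W i h with V (proj₁ (ends i)) in V₁ | V (proj₂ (ends i)) in V₂
  ... | true | true rewrite V⊆W _ V₁ | V⊆W _ V₂ = refl

  induced-∩ : ∀ V W → induced (V ∩ W) ≗ induced V ∩ induced W
  induced-∩ V W i with V (proj₁ (ends i)) | V (proj₂ (ends i)) | W (proj₁ (ends i)) | W (proj₂ (ends i))
  ... | true  | true  | _     | _     = refl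
  ... | true  | false | true  | _     = refl
  ... | true  | false | false | _     = refl
  ... | false | _     | true  | _     = refl
  ... | false | _     | false | _     = refl

  induced-∩⁺ : ∀ V W {x} → induced V x ≡ true → induced W x ≡ true → induced (V ∩ W) x ≡ true
  induced-∩⁺ V W {x} Vx Wx = trans (induced-∩ V W x) (cong₂ _∧_ Vx Wx)

  induced-nonempty : ∀ {W x} → induced W x ≡ true → Nonempty W
  induced-nonempty {W} {x} h with W (proj₁ (ends x)) in W₁
  ... | true = proj₁ (ends x) , W₁

  induced-disjoint : ∀ {p} {P : Fin p → 𝒫 n} → (∀ v → ℕΣ.sum (λ j → iverson (P j v)) ℕ.≤ 1) →
                     ∀ i → ℕΣ.sum (λ j → iverson (induced (P j) i)) ℕ.≤ 1
  induced-disjoint {P = P} disjoint i = ℕ.≤-trans (sum-mono (first-end ∘ P)) (disjoint (proj₁ (ends i)))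
    where
    first-end : ∀ W → iverson (induced W i) ℕ.≤ iverson (W (proj₁ (ends i)))
    first-end W with W (proj₁ (ends i))
    ... | true  = iverson≤1 (W (proj₂ (ends i)))
    ... | false = z≤n

  spanned-cong : ∀ {F F′ V W} → F ≗ F′ → V ≗ W → spanned F V ≡ spanned F′ W
  spanned-cong F≗F′ V≗W = card-cong (λ i → cong₂ _∧_ (F≗F′ i) (cong₂ _∧_ (V≗W _) (V≗W _)))

  spanned-monoˡ : ∀ {F F′} W → F ⊆ F′ → spanned F W ℕ.≤ spanned F′ W
  spanned-monoˡ {F} W F⊆F′ = card-mono (⊆-∩ (⊆-trans (∩-⊆ˡ F _) F⊆F′) (∩-⊆ʳ F _))

  spanned-agree : ∀ {F F′} W → (∀ i → induced W i ≡ true → F i ≡ F′ i) → spanned F W ≡ spanned F′ W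
  spanned-agree {F} {F′} W agree = card-cong pointwise
    where
    pointwise : F ∩ induced W ≗ F′ ∩ induced W
    pointwise i with induced W i in Wi
    ... | true  = cong (_∧ true) (agree i Wi)
    ... | false = trans (∧-zeroʳ (F i)) (sym (∧-zeroʳ (F′ i)))

  spanned-insert : ∀ {F x} W → F x ≡ false →
                   spanned (insert x F) W ≡ spanned F W ℕ.+ iverson (induced W x)
  spanned-insert {F} {x} W Fx = begin
    spanned (insert x F) W
      ≡⟨ ℕ.+-identityʳ _ ⟨
    spanned (insert x F) W ℕ.+ 0
      ≡⟨ cong (λ b → spanned (insert x F) W ℕ.+ iverson (b ∧ induced W x)) Fx ⟨
    spanned (insert x F) W ℕ.+ iverson ((F ∩ induced W) x)
      ≡⟨ card-except x _ _ (λ i i≢x → cong (_∧ induced W i) (insert-there F i≢x)) ⟩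
    spanned F W ℕ.+ iverson ((insert x F ∩ induced W) x)
      ≡⟨ cong (λ b → spanned F W ℕ.+ iverson (b ∧ induced W x)) (insert-here x F) ⟩
    spanned F W ℕ.+ iverson (induced W x) ∎
    where open ≡-Reasoning

  spanned-remove : ∀ {F y} W → F y ≡ true →
                   spanned F W ≡ spanned (remove y F) W ℕ.+ iverson (induced W y)
  spanned-remove {F} {y} W Fy = begin
    spanned F W
      ≡⟨ ℕ.+-identityʳ _ ⟨
    spanned F W ℕ.+ 0
      ≡⟨ cong (λ b → spanned F W ℕ.+ iverson (b ∧ induced W y)) (remove-here y F) ⟨
    spanned F W ℕ.+ iverson ((remove y F ∩ induced W) y)
      ≡⟨ card-except y _ _ (λ i i≢y → cong (_∧ induced W i) (sym (remove-there F i≢y))) ⟩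
    spanned (remove y F) W ℕ.+ iverson ((F ∩ induced W) y)
      ≡⟨ cong (λ b → spanned (remove y F) W ℕ.+ iverson (b ∧ induced W y)) Fy ⟩
    spanned (remove y F) W ℕ.+ iverson (induced W y) ∎
    where open ≡-Reasoning

  spanned-exchange : ∀ {F x y} W → F x ≡ false → F y ≡ true →
    spanned (remove y (insert x F)) W ℕ.+ iverson (induced W y) ≡ spanned F W ℕ.+ iverson (induced W x)
  spanned-exchange {F} {x} {y} W Fx Fy =
    trans (sym (spanned-remove W (⊆-insert x {F} y Fy))) (spanned-insert W Fx)

  spanned-supermodular : ∀ F V W →
    spanned F V ℕ.+ spanned F W ℕ.≤ spanned F (V ∪ W) ℕ.+ spanned F (V ∩ W)
  spanned-supermodular F V W = begin
    spanned F V ℕ.+ spanned F W             ≡⟨ card-∪∩ FV FW ⟨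
    card (FV ∪ FW) ℕ.+ card (FV ∩ FW)       ≤⟨ ℕ.+-mono-≤ (card-mono union) (card-mono intersection) ⟩
    spanned F (V ∪ W) ℕ.+ spanned F (V ∩ W) ∎
    where
    open ℕ.≤-Reasoning
    FV FW : 𝒫 m
    FV = F ∩ induced V
    FW = F ∩ induced W
    union : FV ∪ FW ⊆ F ∩ induced (V ∪ W)
    union = ∪-⊆ (⊆-∩ (∩-⊆ˡ F _) (⊆-trans (∩-⊆ʳ F _) (induced-mono (⊆-∪ˡ V W))))
                (⊆-∩ (∩-⊆ˡ F _) (⊆-trans (∩-⊆ʳ F _) (induced-mono (⊆-∪ʳ V W))))
    intersection : FV ∩ FW ⊆ F ∩ induced (V ∩ W)
    intersection = ⊆-∩ (⊆-trans (∩-⊆ˡ FV FW) (∩-⊆ˡ F _))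
      (λ i h → trans (induced-∩ V W i)
                     (⊆-∩ (⊆-trans (∩-⊆ˡ FV FW) (∩-⊆ʳ F _))
                          (⊆-trans (∩-⊆ʳ FV FW) (∩-⊆ʳ F _)) i h))

  -- The count matroid of (a , b)-sparse edge sets

  module CountMatroid (a b : ℤ) (0≤a : + 0 ≤ a) (b≥-a : - a ≤ b) where

    private instance
      a-nonNegative : ℤ.NonNegative a
      a-nonNegative = ℤ.nonNegative 0≤a

    capacity : 𝒫 n → ℤ
    capacity W = a * + card W + b

    record Independent (F : 𝒫 m) : Set where
      constructor independent
      field bounded : ∀ W → Nonempty W → + spanned F W ≤ capacity W
    open Independent public

    Tight : 𝒫 m → 𝒫 n → Set
    Tight F W = + spanned F W ≡ capacity W

    capacity-cong : ∀ {V W} → V ≗ W → capacity V ≡ capacity W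
    capacity-cong V≗W = cong (λ c → a * + c + b) (card-cong V≗W)

    capacity-nonneg : ∀ {W} → Nonempty W → + 0 ≤ capacity W
    capacity-nonneg {W} W≠∅ = begin
      + 0             ≡⟨ ℤ.+-inverseʳ a ⟨
      a + - a         ≤⟨ ℤ.+-monoʳ-≤ a b≥-a ⟩
      a + b           ≡⟨ cong (_+ b) (ℤ.*-identityʳ a) ⟨
      a * + 1 + b     ≤⟨ ℤ.+-monoˡ-≤ b (ℤ.*-monoˡ-≤-nonNeg a (ℤ.+≤+ (card-pos W≠∅))) ⟩
      capacity W      ∎
      where open ℤ.≤-Reasoning

    capacity-modular : ∀ V W → capacity (V ∪ W) + capacity (V ∩ W) ≡ capacity V + capacity W
    capacity-modular V W = begin
      capacity (V ∪ W) + capacity (V ∩ W)      ≡⟨ distrib a b (+ card (V ∪ W)) (+ card (V ∩ W)) ⟩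
      a * (+ card (V ∪ W) + + card (V ∩ W)) + (b + b)
        ≡⟨ cong (λ c → a * c + (b + b)) cards ⟩
      a * (+ card V + + card W) + (b + b)      ≡⟨ distrib a b (+ card V) (+ card W) ⟨
      capacity V + capacity W                  ∎
      where
      open ≡-Reasoning
      cards : + card (V ∪ W) + + card (V ∩ W) ≡ + card V + + card W
      cards = trans (sym (ℤ.pos-+ (card (V ∪ W)) (card (V ∩ W))))
                    (trans (cong +_ (card-∪∩ V W)) (ℤ.pos-+ (card V) (card W)))
      distrib : ∀ a b x y → a * x + b + (a * y + b) ≡ a * (x + y) + (b + b)
      distrib = solve-∀

    Independent-⊆ : ∀ {F F′} → F ⊆ F′ → Independent F′ → Independent F
    Independent-⊆ F⊆F′ F′-ind = independent λ W W≠∅ →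
      ℤ.≤-trans (ℤ.+≤+ (spanned-monoˡ W F⊆F′)) (bounded F′-ind W W≠∅)

    Independent-cong : ∀ {F F′} → F ≗ F′ → Independent F → Independent F′
    Independent-cong F≗F′ = Independent-⊆ (λ i h → trans (F≗F′ i) h)

    Independent-∅ : Independent (λ _ → false)
    Independent-∅ = independent λ W W≠∅ →
      subst (λ s → + s ≤ capacity W) (sym (ℕΣ.sum-replicate-zero m)) (capacity-nonneg W≠∅)

    Violation : 𝒫 m → 𝒫 n → Set
    Violation F W = Nonempty W × capacity W < + spanned F W

    independent? : ∀ F → Independent F ⊎ Σ (𝒫 n) (Violation F)
    independent? F with exists? (λ W → nonempty? W Dec.×-dec (capacity W ℤ.<? + spanned F W)) respects
      where
      respects : Respects≗ (Violation F)
      respects V≗W ((v , Vv) , V-over) =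
        (v , trans (sym (V≗W v)) Vv) ,
        subst₂ _<_ (capacity-cong V≗W) (cong +_ (spanned-cong {F} (λ _ → refl) V≗W)) V-over
    ... | yes violation = inj₂ violation
    ... | no none       = inj₁ (independent λ W W≠∅ → ℤ.≮⇒≥ (λ over → none (W , W≠∅ , over)))

    Independent? : ∀ F → Dec (Independent F)
    Independent? F with independent? F
    ... | inj₁ F-ind                 = yes F-ind
    ... | inj₂ (W , W≠∅ , W-over) = no (λ F-ind → ℤ.<⇒≱ W-over (bounded F-ind W W≠∅))

    Tight-cong : ∀ {F V W} → V ≗ W → Tight F V → Tight F W
    Tight-cong {F} V≗W V-tight =
      trans (cong +_ (spanned-cong {F} (λ _ → refl) (λ v → sym (V≗W v)))) (trans V-tight (capacity-cong V≗W))

    -- spanned F is supermodular and capacity is modular, so both bounds below are attained.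
    tight-∩∪ : ∀ {F V W} → Independent F → Tight F V → Tight F W → Nonempty (V ∩ W) →
               Tight F (V ∩ W) × Tight F (V ∪ W)
    tight-∩∪ {F} {V} {W} F-ind V-tight W-tight (v , VWv) =
      +-squeeze ∩-bound ∪-bound (subst₂ _≤_ (ℤ.+-comm (capacity (V ∪ W)) _)
                                            (ℤ.+-comm (+ spanned F (V ∪ W)) (+ spanned F (V ∩ W))) sum-bound) ,
      +-squeeze ∪-bound ∩-bound sum-bound
      where
      ∩-bound : + spanned F (V ∩ W) ≤ capacity (V ∩ W)
      ∩-bound = bounded F-ind (V ∩ W) (v , VWv)
      ∪-bound : + spanned F (V ∪ W) ≤ capacity (V ∪ W)
      ∪-bound = bounded F-ind (V ∪ W) (v , ⊆-∪ˡ V W v (∩-⊆ˡ V W v VWv))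
      sum-bound : capacity (V ∪ W) + capacity (V ∩ W) ≤ + spanned F (V ∪ W) + + spanned F (V ∩ W)
      sum-bound = begin
        capacity (V ∪ W) + capacity (V ∩ W)       ≡⟨ capacity-modular V W ⟩
        capacity V + capacity W                   ≡⟨ cong₂ _+_ V-tight W-tight ⟨
        + spanned F V + + spanned F W             ≡⟨ ℤ.pos-+ (spanned F V) (spanned F W) ⟨
        + (spanned F V ℕ.+ spanned F W)           ≤⟨ ℤ.+≤+ (spanned-supermodular F V W) ⟩
        + (spanned F (V ∪ W) ℕ.+ spanned F (V ∩ W)) ≡⟨ ℤ.pos-+ (spanned F (V ∪ W)) (spanned F (V ∩ W)) ⟩
        + spanned F (V ∪ W) + + spanned F (V ∩ W) ∎
        where open ℤ.≤-Reasoning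

    Exchange : 𝒫 m → Fin m → Fin m → Set
    Exchange F x y = Independent (remove y (insert x F))

    overfull : ∀ {F F′ W} → Nonempty W → Tight F W → spanned F′ W ≡ suc (spanned F W) → ¬ Independent F′
    overfull W≠∅ W-tight more F′-ind =
      ℤ.<⇒≱ (subst₂ _<_ W-tight (cong +_ (sym more)) (ℤ.+<+ (ℕ.n<1+n _))) (bounded F′-ind _ W≠∅)

    tight-blocks-insert : ∀ {F x W} → Tight F W → F x ≡ false → induced W x ≡ true →
                          ¬ Independent (insert x F)
    tight-blocks-insert {F} {x} {W} W-tight Fx Wx = overfull {F} (induced-nonempty Wx) W-tight
      (trans (spanned-insert W Fx) (trans (cong (λ b → spanned F W ℕ.+ iverson b) Wx) (ℕ.+-comm _ 1)))

    violation-is-tight : ∀ {F x W} → Independent F → F x ≡ false → Violation (insert x F) W →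
                         Tight F W × induced W x ≡ true
    violation-is-tight {F} {x} {W} F-ind Fx (W≠∅ , over)
      with induced W x | spanned-insert {F} W Fx
    ... | false | count = ⊥-elim (ℤ.<⇒≱ over (subst (λ s → + s ≤ capacity W)
                                                   (sym (trans count (ℕ.+-identityʳ _))) (bounded F-ind W W≠∅)))
    ... | true  | count = ℤ.≤-antisym (bounded F-ind W W≠∅)
                            (ℤ.i<j⇒i≤pred[j] (subst (λ s → capacity W < + s) (trans count (ℕ.+-comm _ 1)) over)) ,
                          refl

    -- Its F-edges together with x form the circuit of x in the count matroid.
    record LeastTight (F : 𝒫 m) (x : Fin m) (T : 𝒫 n) : Set where
      field
        tight : Tight F T
        spans : induced T x ≡ true
        least : ∀ W → Tight F W → induced W x ≡ true → T ⊆ W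

    least-tight : ∀ {F x} → Independent F → F x ≡ false → ¬ Independent (insert x F) →
                  Σ (𝒫 n) (LeastTight F x)
    least-tight {F} {x} F-ind Fx dependent with independent? (insert x F)
    ... | inj₁ ind                = ⊥-elim (dependent ind)
    ... | inj₂ (W₀ , violation)
      with minimum-card {Q = λ W → Tight F W × induced W x ≡ true}
             (λ W → (+ spanned F W ℤ.≟ capacity W) Dec.×-dec (induced W x ≟ᵇ true))
             (λ V≗W (V-tight , Vx) → Tight-cong {F} V≗W V-tight ,
                                     trans (sym (cong₂ _∧_ (V≗W _) (V≗W _))) Vx)
             (violation-is-tight F-ind Fx violation)
    ... | T , (T-tight , Tx) , minimal = T , record { tight = T-tight ; spans = Tx ; least = least }
      where
      least : ∀ W → Tight F W → induced W x ≡ true → T ⊆ W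
      least W W-tight Wx v Tv with W v in Wv
      ... | true  = refl
      ... | false = ⊥-elim (ℕ.<⇒≱ (card-< (∩-⊆ˡ T W) (trans (cong (_∧ W v) Tv) Wv) Tv)
                                  (minimal (T ∩ W) (proj₁ (tight-∩∪ {F} F-ind T-tight W-tight TW≠∅) , TWx)))
        where
        TWx : induced (T ∩ W) x ≡ true
        TWx = induced-∩⁺ T W Tx Wx
        TW≠∅ : Nonempty (T ∩ W)
        TW≠∅ = induced-nonempty TWx

    exchange-within-least-tight : ∀ {F x y T} → Independent F → F x ≡ false → LeastTight F x T →
                                  F y ≡ true → induced T y ≡ true → Exchange F x y
    exchange-within-least-tight {F} {x} {y} {T} F-ind Fx T-least Fy Ty = independent bound
      where
      bound : ∀ W → Nonempty W → + spanned (remove y (insert x F)) W ≤ capacity W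
      bound W W≠∅ with induced W x in Wx | induced W y in Wy | spanned-exchange {F} W Fx Fy
      ... | false | _     | count =
        ℤ.≤-trans (ℤ.+≤+ (ℕ.m+n≤o⇒m≤o _ (ℕ.≤-reflexive (trans count (ℕ.+-identityʳ _)))))
                  (bounded F-ind W W≠∅)
      ... | true  | true  | count =
        subst (λ s → + s ≤ capacity W) (sym (ℕ.+-cancelʳ-≡ 1 _ _ count)) (bounded F-ind W W≠∅)
      ... | true  | false | count = subst (λ s → + s ≤ capacity W)
                                      (sym (trans (sym (ℕ.+-identityʳ _)) (trans count (ℕ.+-comm _ 1))))
                                      (ℤ.i<j⇒suc[i]≤j (ℤ.≤∧≢⇒< (bounded F-ind W W≠∅) W-loose))
        where
        W-loose : ¬ Tight F W
        W-loose W-tight with () ← trans (sym Wy) (induced-mono (LeastTight.least T-least W W-tight Wx) y Ty)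

    tight-contains-exchange : ∀ {F x y T} → Tight F T → induced T x ≡ true → F x ≡ false → F y ≡ true →
                              Exchange F x y → induced T y ≡ true
    tight-contains-exchange {F} {x} {y} {T} T-tight Tx Fx Fy
      with induced T y in Ty | spanned-exchange {F} T Fx Fy
    ... | true  | _     = λ _ → refl
    ... | false | count = ⊥-elim ∘ overfull {F} (induced-nonempty Tx) T-tight
      (trans (sym (ℕ.+-identityʳ _))
             (trans count (trans (cong (λ b → spanned F T ℕ.+ iverson b) Tx) (ℕ.+-comm _ 1))))

    -- z lies in no F-tight set, so the least tight set of x is the same for F and F + z.
    Exchange-insert : ∀ {F x y z} → Independent F → F z ≡ false → Independent (insert z F) →
      F x ≡ false → x ≢ z → ¬ Independent (insert x F) → F y ≡ true →
      Exchange F x y → Exchange (insert z F) x y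
    Exchange-insert {F} {x} {y} {z} F-ind Fz Fz-ind Fx x≢z x-dependent Fy x↔y
      with least-tight F-ind Fx x-dependent
    ... | T , T-least = exchange-within-least-tight Fz-ind (trans (insert-there F x≢z) Fx) T-least′
                          (⊆-insert z {F} y Fy) (tight-contains-exchange {F} tight spans Fx Fy x↔y)
      where
      open LeastTight T-least
      avoids-z : ∀ {C} → Tight F C → induced C z ≡ false
      avoids-z {C} C-tight with induced C z in Cz
      ... | false = refl
      ... | true  = ⊥-elim (tight-blocks-insert C-tight Fz Cz Fz-ind)
      unchanged : ∀ C → induced C z ≡ false → spanned (insert z F) C ≡ spanned F C
      unchanged C Cz = spanned-agree C (λ i Ci → insert-there F (λ { refl → true≢false (trans (sym Ci) Cz) }))
      T-tight′ : Tight (insert z F) T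
      T-tight′ = trans (cong +_ (unchanged T (avoids-z tight))) tight
      meet-tight : ∀ W → Tight (insert z F) W → induced W x ≡ true → Tight F (T ∩ W)
      meet-tight W W-tight Wx = trans (cong +_ (sym (unchanged (T ∩ W) TW-avoids-z))) TW-tight
        where
        TW-tight : Tight (insert z F) (T ∩ W)
        TW-tight = proj₁ (tight-∩∪ {insert z F} Fz-ind T-tight′ W-tight
                                   (induced-nonempty (induced-∩⁺ T W spans Wx)))
        TW-avoids-z : induced (T ∩ W) z ≡ false
        TW-avoids-z = ⊆-false (induced-mono (∩-⊆ˡ T W)) (avoids-z tight)
      T-least′ : LeastTight (insert z F) x T
      T-least′ = record
        { tight = T-tight′
        ; spans = spans
        ; least = λ W W-tight Wx →
            ⊆-trans (least (T ∩ W) (meet-tight W W-tight Wx) (induced-∩⁺ T W spans Wx)) (∩-⊆ʳ T W)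
        }

    -- y₀ is not spanned by the least tight set of x, so that set stays tight after removing y₀.
    Exchange-remove : ∀ {F x y y₀} → Independent F → F y₀ ≡ true → F x ≡ false →
      ¬ Independent (insert x F) → ¬ Exchange F x y₀ → F y ≡ true → y ≢ y₀ →
      Exchange (remove y₀ F) x y → Exchange F x y
    Exchange-remove {F} {x} {y} {y₀} F-ind Fy₀ Fx x-dependent ¬x↔y₀ Fy y≢y₀ x↔y
      with least-tight F-ind Fx x-dependent
    ... | T , T-least = exchange-within-least-tight F-ind Fx T-least Fy
                          (tight-contains-exchange {remove y₀ F} T-tight′ spans
                             (⊆-false {i = x} (remove-⊆ y₀ {F}) Fx) (trans (remove-there F y≢y₀) Fy) x↔y)
      where
      open LeastTight T-least
      T-avoids-y₀ : induced T y₀ ≡ false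
      T-avoids-y₀ with induced T y₀ in Ty₀
      ... | false = refl
      ... | true  = ⊥-elim (¬x↔y₀ (exchange-within-least-tight F-ind Fx T-least Fy₀ Ty₀))
      T-tight′ : Tight (remove y₀ F) T
      T-tight′ = trans (cong +_ (spanned-agree T (λ i Ti →
                         remove-there F (λ { refl → true≢false (trans (sym Ti) T-avoids-y₀) })))) tight

    record GreatestTight (F : 𝒫 m) (x : Fin m) (P : 𝒫 n) : Set where
      field
        tight    : Tight F P
        spans    : induced P x ≡ true
        greatest : ∀ W → Tight F W → Nonempty (P ∩ W) → W ⊆ P

    greatest-tight : ∀ {F x W₀} → Independent F → Tight F W₀ → induced W₀ x ≡ true →
                     Σ (𝒫 n) (GreatestTight F x)
    greatest-tight {F} {x} F-ind W₀-tight W₀x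
      with maximum-card {Q = λ W → Tight F W × induced W x ≡ true}
             (λ W → (+ spanned F W ℤ.≟ capacity W) Dec.×-dec (induced W x ≟ᵇ true))
             (λ V≗W (V-tight , Vx) → Tight-cong {F} V≗W V-tight ,
                                     trans (sym (cong₂ _∧_ (V≗W _) (V≗W _))) Vx)
             (W₀-tight , W₀x)
    ... | P , (P-tight , Px) , maximal = P , record { tight = P-tight ; spans = Px ; greatest = greatest }
      where
      greatest : ∀ W → Tight F W → Nonempty (P ∩ W) → W ⊆ P
      greatest W W-tight P∩W≠∅ v Wv with P v in Pv
      ... | true  = refl
      ... | false = ⊥-elim (ℕ.<⇒≱ (card-< (⊆-∪ˡ P W) Pv (trans (cong (_∨ W v) Pv) Wv))
                                  (maximal (P ∪ W) (proj₂ (tight-∩∪ {F} F-ind P-tight W-tight P∩W≠∅) ,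
                                                    induced-mono (⊆-∪ˡ P W) x Px)))

    Covered : 𝒫 m → 𝒫 m → Set
    Covered F S = ∀ x → S x ≡ true → Σ (𝒫 n) λ W → Tight F W × induced W x ≡ true

    record TightCover (F S : 𝒫 m) : Set where
      field
        size     : ℕ
        part     : Fin size → 𝒫 n
        tight    : ∀ j → Tight F (part j)
        disjoint : ∀ v → ℕΣ.sum (λ j → iverson (part j v)) ℕ.≤ 1
        covers   : ∀ x → S x ≡ true → ∃ λ j → induced (part j) x ≡ true
        meets    : ∀ j → ∃ λ y → S y ≡ true × induced (part j) y ≡ true

    empty-cover : ∀ {F S} → ¬ Nonempty S → TightCover F S
    empty-cover S=∅ = record
      { size = 0 ; part = λ () ; tight = λ () ; disjoint = λ _ → z≤n
      ; covers = λ x Sx → ⊥-elim (S=∅ (x , Sx)) ; meets = λ () }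

    cover-∷ : ∀ {F S x P} → S x ≡ true → GreatestTight F x P →
              TightCover F (S ∩ ∁ (induced P)) → TightCover F S
    cover-∷ {F} {S} {x} {P} Sx P-greatest rest = record
      { size     = suc size
      ; part     = P Vector.∷ part
      ; tight    = λ { zero → P-tight ; (suc j) → tight j }
      ; disjoint = disjoint′
      ; covers   = covers′
      ; meets    = λ { zero → x , Sx , spans
                     ; (suc j) → let (y , S′y , Py) = meets j in y , ∩-⊆ˡ S (∁ (induced P)) y S′y , Py }
      }
      where
      open GreatestTight P-greatest renaming (tight to P-tight)
      open TightCover rest
      apart : ∀ j v → P v ≡ true → part j v ≡ false
      apart j v Pv with part j v in Qv | meets j
      ... | false | _ = refl
      ... | true  | y , S′y , Qy =
        ⊥-elim (true≢false (sym (trans (sym (cong not P-spans-y)) (∩-⊆ʳ S (∁ (induced P)) y S′y))))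
        where
        P-spans-y : induced P y ≡ true
        P-spans-y = induced-mono (greatest (part j) (tight j) (v , cong₂ _∧_ Pv Qv)) y Qy
      disjoint′ : ∀ v → iverson (P v) ℕ.+ ℕΣ.sum (λ j → iverson (part j v)) ℕ.≤ 1
      disjoint′ v with P v in Pv
      ... | false = disjoint v
      ... | true  = s≤s (ℕ.≤-reflexive (trans (ℕΣ.sum-cong-≗ (λ j → cong iverson (apart j v Pv)))
                                              (ℕΣ.sum-replicate-zero size)))
      covers′ : ∀ y → S y ≡ true → ∃ λ j → induced ((P Vector.∷ part) j) y ≡ true
      covers′ y Sy with induced P y in Py
      ... | true  = zero , Py
      ... | false = let (j , Qy) = covers y (cong₂ _∧_ Sy (cong not Py)) in suc j , Qy

    -- Greatest tight sets spanning different edges are equal or disjoint, since the union of two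
    -- intersecting tight sets is tight.
    tight-cover : ∀ {F S} → Independent F → Covered F S → TightCover F S
    tight-cover {F} F-ind covered = build covered (<-wellFounded _)
      where
      build : ∀ {S} → Covered F S → Acc ℕ._<_ (card S) → TightCover F S
      build {S} covered (acc smaller) with nonempty? S
      ... | no S=∅ = empty-cover S=∅
      ... | yes (x , Sx) with covered x Sx
      ... | W₀ , W₀-tight , W₀x with greatest-tight F-ind W₀-tight W₀x
      ... | P , P-greatest =
        cover-∷ Sx P-greatest (build covered′ (smaller (card-< (∩-⊆ˡ S (∁ (induced P))) x-covered Sx)))
        where
        covered′ : Covered F (S ∩ ∁ (induced P))
        covered′ y S′y = covered y (∩-⊆ˡ S (∁ (induced P)) y S′y)
        x-covered : (S ∩ ∁ (induced P)) x ≡ false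
        x-covered = trans (cong (λ b → S x ∧ not b) (GreatestTight.spans P-greatest)) (∧-zeroʳ (S x))

    cover-capacity : ∀ {F S} (C : TightCover F S) → ℤΣ.sum (capacity ∘ TightCover.part C) ≤ + card F
    cover-capacity {F} C = begin
      ℤΣ.sum (capacity ∘ part)                    ≡⟨ ℤΣ.sum-cong-≗ (λ j → sym (tight j)) ⟩
      ℤΣ.sum (λ j → + spanned F (part j))         ≡⟨ +-sum (λ j → spanned F (part j)) ⟨
      + ℕΣ.sum (λ j → spanned F (part j))
        ≤⟨ ℤ.+≤+ (disjoint-card (induced ∘ part) (induced-disjoint {P = part} disjoint) F) ⟩
      + card F                                    ∎
      where
      open TightCover C
      open ℤ.≤-Reasoning

    scale-mono : ∀ {x y} → x ℕ.≤ y → a * + x ≤ a * + y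
    scale-mono x≤y = ℤ.*-monoˡ-≤-nonNeg a (ℤ.+≤+ x≤y)

    capacity-mono : ∀ {V W} → V ⊆ W → capacity V ≤ capacity W
    capacity-mono V⊆W = ℤ.+-monoˡ-≤ b (scale-mono (card-mono V⊆W))

    capacity-∪ : + 0 ≤ b → ∀ V W → capacity (V ∪ W) ≤ capacity V + capacity W
    capacity-∪ 0≤b V W = begin
      a * + card (V ∪ W) + b                ≤⟨ ℤ.+-monoˡ-≤ b (scale-mono union-bound) ⟩
      a * + (card V ℕ.+ card W) + b         ≡⟨ cong (λ t → a * t + b) (ℤ.pos-+ (card V) (card W)) ⟩
      a * (+ card V + + card W) + b         ≡⟨ ℤ.+-identityʳ (a * (+ card V + + card W) + b) ⟨
      a * (+ card V + + card W) + b + + 0   ≤⟨ ℤ.+-monoʳ-≤ (a * (+ card V + + card W) + b) 0≤b ⟩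
      a * (+ card V + + card W) + b + b     ≡⟨ distrib a b (+ card V) (+ card W) ⟩
      capacity V + capacity W               ∎
      where
      open ℤ.≤-Reasoning
      union-bound : card (V ∪ W) ℕ.≤ card V ℕ.+ card W
      union-bound = subst (card (V ∪ W) ℕ.≤_) (card-∪∩ V W) (ℕ.m≤m+n _ _)
      distrib : ∀ a b x y → a * (x + y) + b + b ≡ a * x + b + (a * y + b)
      distrib = solve-∀

    capacity-⋃ : + 0 ≤ b → ∀ {p} (P : Fin p → 𝒫 n) → Fin p → capacity (⋃ P) ≤ ℤΣ.sum (capacity ∘ P)
    capacity-⋃ 0≤b {suc zero}    P _ = ℤ.≤-reflexive (trans (capacity-cong (λ v → ∨-identityʳ (P zero v)))
                                                           (sym (ℤ.+-identityʳ (capacity (P zero)))))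
    capacity-⋃ 0≤b {suc (suc p)} P _ = ℤ.≤-trans (capacity-∪ 0≤b (P zero) _)
                                         (ℤ.+-monoʳ-≤ (capacity (P zero)) (capacity-⋃ 0≤b (P ∘ suc) zero))

    sum-of-charges : b ≤ + 0 → ∀ {q} {g : Fin q → ℤ} (c : Fin q → ℕ) →
                     (∀ j → g j ≡ + 0 ⊎ g j ≡ a * + c j + b) →
                     ℤΣ.sum g ≡ + 0 ⊎ ℤΣ.sum g ≤ a * + ℕΣ.sum c + b
    sum-of-charges b≤0 {zero}  c charges = inj₁ refl
    sum-of-charges b≤0 {suc q} {g} c charges with charges zero | sum-of-charges b≤0 (c ∘ suc) (charges ∘ suc)
    ... | inj₁ g₀≡0 | inj₁ rest≡0 = inj₁ (cong₂ _+_ g₀≡0 rest≡0)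
    ... | inj₁ g₀≡0 | inj₂ rest≤  = inj₂ (begin
      g zero + ℤΣ.sum (g ∘ suc)          ≡⟨ cong (_+ ℤΣ.sum (g ∘ suc)) g₀≡0 ⟩
      + 0 + ℤΣ.sum (g ∘ suc)             ≡⟨ ℤ.+-identityˡ _ ⟩
      ℤΣ.sum (g ∘ suc)                   ≤⟨ rest≤ ⟩
      a * + C + b                        ≤⟨ ℤ.+-monoˡ-≤ b (scale-mono (ℕ.m≤n+m C (c zero))) ⟩
      a * + (c zero ℕ.+ C) + b           ∎)
      where
      open ℤ.≤-Reasoning
      C : ℕ
      C = ℕΣ.sum (c ∘ suc)
    ... | inj₂ g₀≡ | inj₁ rest≡0 = inj₂ (begin
      g zero + ℤΣ.sum (g ∘ suc)          ≡⟨ cong₂ _+_ g₀≡ rest≡0 ⟩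
      a * + c zero + b + + 0             ≡⟨ ℤ.+-identityʳ _ ⟩
      a * + c zero + b                   ≤⟨ ℤ.+-monoˡ-≤ b (scale-mono (ℕ.m≤m+n (c zero) C)) ⟩
      a * + (c zero ℕ.+ C) + b           ∎)
      where
      open ℤ.≤-Reasoning
      C : ℕ
      C = ℕΣ.sum (c ∘ suc)
    ... | inj₂ g₀≡ | inj₂ rest≤  = inj₂ (begin
      g zero + ℤΣ.sum (g ∘ suc)          ≤⟨ ℤ.+-mono-≤ (ℤ.≤-reflexive g₀≡) rest≤ ⟩
      a * + c zero + b + (a * + C + b)   ≤⟨ ℤ.+-monoʳ-≤ (a * + c zero + b) (ℤ.+-monoʳ-≤ (a * + C) b≤0) ⟩
      a * + c zero + b + (a * + C + + 0) ≡⟨ regroup a b (+ c zero) (+ C) ⟩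
      a * (+ c zero + + C) + b           ≡⟨ cong (λ t → a * t + b) (ℤ.pos-+ (c zero) C) ⟨
      a * + (c zero ℕ.+ C) + b           ∎)
      where
      open ℤ.≤-Reasoning
      C : ℕ
      C = ℕΣ.sum (c ∘ suc)
      regroup : ∀ a b x y → a * x + b + (a * y + + 0) ≡ a * (x + y) + b
      regroup = solve-∀

-- The exchange graph of two count matroids

data Dichotomy (c : Bool) : Bool → Set where
  same    : Dichotomy c c
  flipped : Dichotomy c (not c)

dichotomy : ∀ c d → Dichotomy c d
dichotomy false false = same
dichotomy false true  = flipped
dichotomy true  true  = same
dichotomy true  false = flipped

∃-Bool? : {P : Bool → Set} → (∀ d → Dec (P d)) → Dec (Σ Bool P)
∃-Bool? P? = Dec.map′ (λ { (inj₁ p) → false , p ; (inj₂ p) → true , p })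
                      (λ { (false , p) → inj₁ p ; (true , p) → inj₂ p })
                      (P? false Dec.⊎-dec P? true)

module ExchangeGraph {n m : ℕ} (ends : Fin m → Fin n × Fin n)
                     (a b : Bool → ℤ) (0≤a : ∀ d → + 0 ≤ a d) (b≥-a : ∀ d → - a d ≤ b d) where

  open Edges ends
  module M (d : Bool) = CountMatroid (a d) (b d) (0≤a d) (b≥-a d)
  open M using (Independent; Exchange; Independent-⊆; Independent-cong)

  -- nothing marks an edge not yet placed in either part.
  Colouring : Set
  Colouring = Fin m → Maybe Bool

  class : Colouring → Bool → 𝒫 m
  class κ d i = does (≡-decₘ _≟ᵇ_ (κ i) (just d))

  Valid : Colouring → Set
  Valid κ = ∀ d → Independent d (class κ d)

  Arc : Colouring → Fin m → Fin m → Set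
  Arc κ x y = Σ Bool λ d → κ y ≡ just d × κ x ≢ just d × Exchange d (class κ d) x y

  Free : Colouring → Fin m → Set
  Free κ x = Σ Bool λ d → κ x ≢ just d × Independent d (insert x (class κ d))

  recolour : Colouring → Fin m → Bool → Colouring
  recolour κ x c i = if does (i ≟ᶠ x) then just c else κ i

  class⁺ : ∀ κ {d} i → κ i ≡ just d → class κ d i ≡ true
  class⁺ κ {d} i κi with ≡-decₘ _≟ᵇ_ (κ i) (just d)
  ... | yes _   = refl
  ... | no κi≢d = ⊥-elim (κi≢d κi)

  class-∉ : ∀ κ {d} i → κ i ≢ just d → class κ d i ≡ false
  class-∉ κ {d} i κi≢d with ≡-decₘ _≟ᵇ_ (κ i) (just d)
  ... | yes κi = ⊥-elim (κi≢d κi)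
  ... | no _   = refl

  class⁻ : ∀ κ {d} i → class κ d i ≡ true → κ i ≡ just d
  class⁻ κ {d} i h with ≡-decₘ _≟ᵇ_ (κ i) (just d)
  ... | yes κi = κi

  uncoloured : Colouring → 𝒫 m
  uncoloured κ i = not (is-just (κ i))

  uncoloured⁺ : ∀ κ {i} → κ i ≡ nothing → uncoloured κ i ≡ true
  uncoloured⁺ κ κi = cong (not ∘ is-just) κi

  uncoloured⁻ : ∀ κ i → uncoloured κ i ≡ true → κ i ≡ nothing
  uncoloured⁻ κ i h with κ i
  ... | nothing = refl

  uncoloured-∉ : ∀ κ i → κ i ≢ nothing → uncoloured κ i ≡ false
  uncoloured-∉ κ i κi≢nothing with κ i
  ... | just _  = refl
  ... | nothing = ⊥-elim (κi≢nothing refl)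

  recolour-here : ∀ κ x c → recolour κ x c x ≡ just c
  recolour-here κ x c with x ≟ᶠ x
  ... | yes _  = refl
  ... | no x≢x = ⊥-elim (x≢x refl)

  recolour-there : ∀ κ c {x i} → i ≢ x → recolour κ x c i ≡ κ i
  recolour-there κ c {x} {i} i≢x with i ≟ᶠ x
  ... | yes i≡x = ⊥-elim (i≢x i≡x)
  ... | no _    = refl

  class-recolour-same : ∀ κ x c i → class (recolour κ x c) c i ≡ insert x (class κ c) i
  class-recolour-same κ x c i with i ≟ᶠ x
  ... | yes refl = class⁺ (λ _ → just c) x refl
  ... | no _     = refl

  class-recolour-other : ∀ κ x {c d} → d ≢ c → ∀ i → class (recolour κ x c) d i ≡ remove x (class κ d) i
  class-recolour-other κ x {c} {d} d≢c i with i ≟ᶠ x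
  ... | yes refl = class-∉ (λ _ → just c) x (λ eq → d≢c (sym (just-injective eq)))
  ... | no _     = refl

  recolour-uncoloured : ∀ κ x c {i} → recolour κ x c i ≡ nothing → κ i ≡ nothing
  recolour-uncoloured κ x c {i} eq with i ≟ᶠ x
  ... | yes refl with () ← eq
  ... | no _     = eq

  not≢ : ∀ c → not c ≢ c
  not≢ false ()
  not≢ true  ()

  recolour-valid : ∀ {κ x c} → Valid κ → Independent c (insert x (class κ c)) → Valid (recolour κ x c)
  recolour-valid {κ} {x} {c} κ-valid x-free d with dichotomy c d
  ... | same    = Independent-cong c (λ i → sym (class-recolour-same κ x c i)) x-free
  ... | flipped = Independent-⊆ (not c)
                    (λ i h → remove-⊆ x {class κ (not c)} i
                               (trans (sym (class-recolour-other κ x (not≢ c) i)) h))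
                    (κ-valid (not c))

  module Recolouring (κ : Colouring) (z : Fin m) (c : Bool) (κ-valid : Valid κ)
                     (κz : κ z ≡ just (not c)) (z-free : Independent c (insert z (class κ c))) where

    κ′ : Colouring
    κ′ = recolour κ z c

    private
      F : Bool → 𝒫 m
      F = class κ

      new : class κ′ c ≗ insert z (F c)
      new = class-recolour-same κ z c

      old : class κ′ (not c) ≗ remove z (F (not c))
      old = class-recolour-other κ z (not≢ c)

      z∉Fc : F c z ≡ false
      z∉Fc = class-∉ κ z (λ eq → not≢ c (just-injective (trans (sym κz) eq)))

      z∈Fnc : F (not c) z ≡ true
      z∈Fnc = class⁺ κ z κz

    arc-preserved : ∀ {x y} → x ≢ z → y ≢ z → ¬ Free κ x → ¬ Arc κ x z → Arc κ x y → Arc κ′ x y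
    arc-preserved {x} {y} x≢z y≢z x-stuck _ (d , κy , κx≢d , x↔y) =
      d , trans (recolour-there κ c y≢z) κy , (λ eq → κx≢d (trans (sym (recolour-there κ c x≢z)) eq)) ,
      exchange (dichotomy c d)
      where
      exchange : Dichotomy c d → Exchange d (class κ′ d) x y
      exchange same    = Independent-cong c (remove-cong y (insert-cong x (λ i → sym (new i))))
        (M.Exchange-insert c (κ-valid c) z∉Fc z-free (class-∉ κ x κx≢d) x≢z
                           (λ ind → x-stuck (c , κx≢d , ind)) (class⁺ κ y κy) x↔y)
      exchange flipped = Independent-⊆ (not c)
        (remove-mono y (insert-mono x (λ i h → remove-⊆ z {F (not c)} i (trans (sym (old i)) h)))) x↔y

    arc-reflected : ∀ {x y} → x ≢ z → y ≢ z → ¬ Free κ x → ¬ Arc κ x z → Arc κ′ x y → Arc κ x y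
    arc-reflected {x} {y} x≢z y≢z x-stuck no-arc (d , κ′y , κ′x≢d , x↔y) =
      d , κy , κx≢d , exchange (dichotomy c d)
      where
      κy : κ y ≡ just d
      κy = trans (sym (recolour-there κ c y≢z)) κ′y
      κx≢d : κ x ≢ just d
      κx≢d eq = κ′x≢d (trans (recolour-there κ c x≢z) eq)
      exchange : Dichotomy c d → Exchange d (F d) x y
      exchange same    = Independent-⊆ c
        (remove-mono y (insert-mono x (λ i h → trans (new i) (⊆-insert z {F c} i h)))) x↔y
      exchange flipped = M.Exchange-remove (not c) (κ-valid (not c)) z∈Fnc (class-∉ κ x κx≢d)
        (λ ind → x-stuck (not c , κx≢d , ind)) (λ x↔z → no-arc (not c , κz , κx≢d , x↔z))
        (class⁺ κ y κy) y≢z (Independent-cong (not c) (remove-cong y (insert-cong x old)) x↔y)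

    free-reflected : ∀ {x} → x ≢ z → ¬ Free κ x → ¬ Arc κ x z → ¬ Free κ′ x
    free-reflected {x} x≢z x-stuck no-arc (d , κ′x≢d , x-free) = blocked (dichotomy c d)
      where
      κx≢d : κ x ≢ just d
      κx≢d eq = κ′x≢d (trans (recolour-there κ c x≢z) eq)
      blocked : Dichotomy c d → ⊥
      blocked same    = x-stuck (c , κx≢d , Independent-⊆ c
        (insert-mono x (λ i h → trans (new i) (⊆-insert z {F c} i h))) x-free)
      blocked flipped = no-arc (not c , κz , κx≢d , Independent-cong (not c)
        (λ i → trans (insert-cong x old i) (insert-remove-comm (F (not c)) x≢z i)) x-free)

    arc-into-z-frees : ∀ {x} → x ≢ z → Arc κ x z → Free κ′ x
    arc-into-z-frees {x} x≢z (d , κz≡d , κx≢d , x↔z) with just-injective (trans (sym κz) κz≡d)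
    ... | refl = not c , (λ eq → κx≢d (trans (sym (recolour-there κ c x≢z)) eq)) ,
                 Independent-cong (not c)
                   (λ i → trans (sym (insert-remove-comm (F (not c)) x≢z i)) (sym (insert-cong x old i))) x↔z

  record ShortestPath (κ : Colouring) (k : ℕ) (z : ℕ → Fin m) : Set where
    field
      arcs          : ∀ t → t ℕ.< k → Arc κ (z t) (z (suc t))
      end-free      : Free κ (z k)
      no-shortcut   : ∀ s t → suc s ℕ.< t → t ℕ.≤ k → ¬ Arc κ (z s) (z t)
      only-end-free : ∀ s → s ℕ.< k → ¬ Free κ (z s)

  shortened : ∀ {κ k z c} → Valid κ → κ (z (suc k)) ≡ just (not c) →
              Independent c (insert (z (suc k)) (class κ c)) →
              ShortestPath κ (suc k) z → ShortestPath (recolour κ (z (suc k)) c) k z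
  shortened {κ} {k} {z} {c} κ-valid κz z-free path = record
    { arcs          = λ t t<k → arc-preserved (distinct t t<k) (before-end (suc t) (s≤s t<k)) (stuck t t<k)
                                              (no-arc-to-end t t<k) (arcs t (ℕ.m<n⇒m<1+n t<k))
    ; end-free      = arc-into-z-frees (before-end k ℕ.≤-refl) (arcs k ℕ.≤-refl)
    ; no-shortcut   = λ s t s+1<t t≤k → let s<k = ℕ.<-≤-trans (ℕ.<-trans (ℕ.n<1+n s) s+1<t) t≤k in
                        no-shortcut s t s+1<t (ℕ.m≤n⇒m≤1+n t≤k) ∘
                        arc-reflected (distinct s s<k) (before-end t (s≤s t≤k)) (stuck s s<k) (no-arc-to-end s s<k)
    ; only-end-free = λ s s<k → free-reflected (distinct s s<k) (stuck s s<k) (no-arc-to-end s s<k)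
    }
    where
    open ShortestPath path
    open Recolouring κ (z (suc k)) c κ-valid κz z-free
    before-end : ∀ s → s ℕ.< suc k → z s ≢ z (suc k)
    before-end s s<k+1 eq = only-end-free s s<k+1 (subst (Free κ) (sym eq) end-free)
    distinct : ∀ s → s ℕ.< k → z s ≢ z (suc k)
    distinct s s<k = before-end s (ℕ.m<n⇒m<1+n s<k)
    stuck : ∀ s → s ℕ.< k → ¬ Free κ (z s)
    stuck s s<k = only-end-free s (ℕ.m<n⇒m<1+n s<k)
    no-arc-to-end : ∀ s → s ℕ.< k → ¬ Arc κ (z s) (z (suc k))
    no-arc-to-end s s<k = no-shortcut s (suc k) (s≤s s<k) ℕ.≤-refl

  Augmented : Colouring → Fin m → Colouring → Set
  Augmented κ e κ′ = Valid κ′ × κ′ e ≢ nothing × (∀ x → κ′ x ≡ nothing → κ x ≡ nothing)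

  -- Recolour the last edge of the path with a colour it is free for; the path minus its last edge
  -- stays shortest, ending in an edge that has just become free.
  augment : ∀ k {κ z} → Valid κ → ShortestPath κ k z → Σ Colouring (Augmented κ (z 0))
  augment zero {κ} {z} κ-valid path with ShortestPath.end-free path
  ... | c , _ , z₀-free = recolour κ (z 0) c , recolour-valid κ-valid z₀-free ,
                          (λ eq → case trans (sym (recolour-here κ (z 0) c)) eq of λ ()) ,
                          λ x → recolour-uncoloured κ (z 0) c
  augment (suc k) {κ} {z} κ-valid path
    with ShortestPath.end-free path | ShortestPath.arcs path k ℕ.≤-refl
  ... | c , κz≢c , z-free | d , κz≡d , _ with dichotomy c d
  ... | same    = ⊥-elim (κz≢c κz≡d)
  ... | flipped with augment k (recolour-valid κ-valid z-free) (shortened κ-valid κz≡d z-free path)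
  ... | κ″ , κ″-valid , coloured , still =
          κ″ , κ″-valid , coloured , λ x → recolour-uncoloured κ (z (suc k)) c ∘ still x

  Arc? : ∀ κ x y → Dec (Arc κ x y)
  Arc? κ x y = ∃-Bool? λ d → ≡-decₘ _≟ᵇ_ (κ y) (just d)
                   Dec.×-dec Dec.¬? (≡-decₘ _≟ᵇ_ (κ x) (just d))
                   Dec.×-dec M.Independent? d (remove y (insert x (class κ d)))

  Free? : ∀ κ x → Dec (Free κ x)
  Free? κ x = ∃-Bool? λ d → Dec.¬? (≡-decₘ _≟ᵇ_ (κ x) (just d))
                  Dec.×-dec M.Independent? d (insert x (class κ d))

  module Search (κ : Colouring) (e : Fin m) where

    layer : ℕ → 𝒫 m
    layer zero    x = does (x ≟ᶠ e)
    layer (suc j) x = layer j x ∨ does (any? λ y → (layer j y ≟ᵇ true) Dec.×-dec Arc? κ y x)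

    e∈layer₀ : layer 0 e ≡ true
    e∈layer₀ with e ≟ᶠ e
    ... | yes _  = refl
    ... | no e≢e = ⊥-elim (e≢e refl)

    layer-step : ∀ j → layer j ⊆ layer (suc j)
    layer-step j x h rewrite h = refl

    layer-mono : ∀ {i j} → i ℕ.≤ j → layer i ⊆ layer j
    layer-mono = mono′ ∘ ℕ.≤⇒≤′
      where
      mono′ : ∀ {i j} → i ℕ.≤′ j → layer i ⊆ layer j
      mono′ ℕ.≤′-refl        = λ _ h → h
      mono′ (ℕ.≤′-step {j} i≤′j) = ⊆-trans (mono′ i≤′j) (layer-step j)

    layer-arc : ∀ j {x y} → layer j y ≡ true → Arc κ y x → layer (suc j) x ≡ true
    layer-arc j {x} {y} y∈j y→x with layer j x | any? (λ w → (layer j w ≟ᵇ true) Dec.×-dec Arc? κ w x)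
    ... | true  | _     = refl
    ... | false | yes _ = refl
    ... | false | no ∄  = ⊥-elim (∄ (y , y∈j , y→x))

    layer-new : ∀ j {x} → layer (suc j) x ≡ true → layer j x ≡ false →
                ∃ λ y → layer j y ≡ true × Arc κ y x
    layer-new j {x} x∈j+1 x∉j with any? (λ w → (layer j w ≟ᵇ true) Dec.×-dec Arc? κ w x)
    ... | yes found = found
    ... | no _ with () ← trans (sym x∈j+1) (cong (_∨ false) x∉j)

    layer-arrival : ∀ j {x} → layer j x ≡ true → x ≡ e ⊎ ∃ λ y → layer j y ≡ true × Arc κ y x
    layer-arrival zero {x} x∈0 with x ≟ᶠ e
    ... | yes x≡e = inj₁ x≡e
    layer-arrival (suc j) {x} x∈j+1 with layer j x ≟ᵇ true
    ... | yes x∈j = Sum.map₂ (λ (y , y∈j , y→x) → y , layer-step j y y∈j , y→x) (layer-arrival j x∈j)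
    ... | no x∉j  = let (y , y∈j , y→x) = layer-new j x∈j+1 (¬-not x∉j) in
                    inj₂ (y , layer-step j y y∈j , y→x)

    FirstIn : ℕ → Fin m → Set
    FirstIn k x = layer k x ≡ true × (∀ i → i ℕ.< k → layer i x ≡ false)

    record PathTo (k : ℕ) (x : Fin m) : Set where
      field
        vertex : ℕ → Fin m
        start  : vertex 0 ≡ e
        end    : vertex k ≡ x
        arcs   : ∀ t → t ℕ.< k → Arc κ (vertex t) (vertex (suc t))
        first  : ∀ t → t ℕ.≤ k → FirstIn t (vertex t)

    path-snoc : ∀ {k x y} → PathTo k y → Arc κ y x → FirstIn (suc k) x → PathTo (suc k) x
    path-snoc {k} {x} {y} p y→x x-first = record
      { vertex = vertex′ ; start = trans (below z≤n) start ; end = top ; arcs = arcs′ ; first = first′ }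
      where
      open PathTo p
      vertex′ : ℕ → Fin m
      vertex′ t with t ℕ.≟ suc k
      ... | yes _ = x
      ... | no _  = vertex t
      below : ∀ {t} → t ℕ.≤ k → vertex′ t ≡ vertex t
      below {t} t≤k with t ℕ.≟ suc k
      ... | yes refl = ⊥-elim (ℕ.<-irrefl refl t≤k)
      ... | no _     = refl
      top : vertex′ (suc k) ≡ x
      top with suc k ℕ.≟ suc k
      ... | yes _  = refl
      ... | no k≢k = ⊥-elim (k≢k refl)
      arcs′ : ∀ t → t ℕ.< suc k → Arc κ (vertex′ t) (vertex′ (suc t))
      arcs′ t t<k+1 with ℕ.m≤n⇒m<n∨m≡n (ℕ.≤-pred t<k+1)
      ... | inj₁ t<k  = subst₂ (Arc κ) (sym (below (ℕ.<⇒≤ t<k))) (sym (below t<k)) (arcs t t<k)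
      ... | inj₂ refl = subst₂ (Arc κ) (sym (trans (below ℕ.≤-refl) end)) (sym top) y→x
      first′ : ∀ t → t ℕ.≤ suc k → FirstIn t (vertex′ t)
      first′ t t≤k+1 with ℕ.m≤n⇒m<n∨m≡n t≤k+1
      ... | inj₁ t<k+1 = subst (FirstIn t) (sym (below (ℕ.≤-pred t<k+1))) (first t (ℕ.≤-pred t<k+1))
      ... | inj₂ refl  = subst (FirstIn (suc k)) (sym top) x-first

    path-to : ∀ k {x} → FirstIn k x → PathTo k x
    path-to zero {x} (x∈0 , _) with x ≟ᶠ e
    ... | yes refl = record
      { vertex = λ _ → e ; start = refl ; end = refl ; arcs = λ _ ()
      ; first = λ { zero _ → e∈layer₀ , λ _ () ; (suc _) () } }
    path-to (suc k) {x} (x∈k+1 , x-new) with layer-new k x∈k+1 (x-new k ℕ.≤-refl)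
    ... | y , y∈k , y→x = path-snoc (path-to k (y∈k , y-new)) y→x (x∈k+1 , x-new)
      where
      y-new : ∀ i → i ℕ.< k → layer i y ≡ false
      y-new i i<k with layer i y in y∈i
      ... | false = refl
      ... | true  with () ← trans (sym (layer-mono i<k x (layer-arc i y∈i y→x))) (x-new k ℕ.≤-refl)

    HasFree : ℕ → Set
    HasFree j = ∃ λ x → layer j x ≡ true × Free κ x

    HasFree? : ∀ j → Dec (HasFree j)
    HasFree? j = any? (λ x → (layer j x ≟ᵇ true) Dec.×-dec Free? κ x)

    first-free : ∀ j → (∃ λ k → HasFree k × (∀ i → i ℕ.< k → ¬ HasFree i)) ⊎ ¬ HasFree j
    first-free j with HasFree? j
    first-free zero    | yes found = inj₁ (0 , found , λ _ ())
    first-free (suc j) | yes found with first-free j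
    ... | inj₁ earlier   = inj₁ earlier
    ... | inj₂ none-at-j = inj₁ (suc j , found , λ i i≤j (x , x∈i , x-free) →
                                   none-at-j (x , layer-mono (ℕ.≤-pred i≤j) x x∈i , x-free))
    first-free j       | no none = inj₂ none

    -- An arc from the s-th vertex of a path along first layers reaches layer s + 1, so it cannot skip ahead.
    shortest-path : ∀ {k} → HasFree k → (∀ i → i ℕ.< k → ¬ HasFree i) →
                    Σ (ℕ → Fin m) λ z → z 0 ≡ e × ShortestPath κ k z
    shortest-path {k} (x , x∈k , x-free) none-before = vertex , start , record
      { arcs          = arcs
      ; end-free      = subst (Free κ) (sym end) x-free
      ; no-shortcut   = λ s t s+1<t t≤k s→t →
          let s≤k = ℕ.<⇒≤ (ℕ.<-≤-trans (ℕ.<-trans (ℕ.n<1+n s) s+1<t) t≤k) in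
          true≢false (trans (sym (layer-arc s (proj₁ (first s s≤k)) s→t)) (proj₂ (first t t≤k) (suc s) s+1<t))
      ; only-end-free = λ s s<k s-free → none-before s s<k (vertex s , proj₁ (first s (ℕ.<⇒≤ s<k)) , s-free)
      }
      where
      x-first : FirstIn k x
      x-first = x∈k , λ i i<k → ¬-not (λ x∈i → none-before i i<k (x , x∈i , x-free))
      open PathTo (path-to k x-first)

    -- The layers grow strictly until they stabilise, so they stabilise within m steps.
    growth : ∀ j → (Σ ℕ λ N → layer (suc N) ≗ layer N) ⊎ suc j ℕ.≤ card (layer j)
    growth zero = inj₂ (card-pos (e , e∈layer₀))
    growth (suc j) with growth j
    ... | inj₁ stable = inj₁ stable
    ... | inj₂ big with all? (λ x → layer (suc j) x ≟ᵇ layer j x)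
    ...   | yes unchanged = inj₁ (j , unchanged)
    ...   | no differ with ¬∀⟶∃¬ m _ (λ x → layer (suc j) x ≟ᵇ layer j x) differ
    ...     | x , x-new = inj₂ (ℕ.≤-trans (s≤s big) (card-< (layer-step j) x∉j x∈j+1))
      where
      x∉j : layer j x ≡ false
      x∉j with layer j x in x∈j
      ... | true  = ⊥-elim (x-new refl)
      ... | false = refl
      x∈j+1 : layer (suc j) x ≡ true
      x∈j+1 = ¬-not (λ eq → x-new (trans eq (sym x∉j)))

    stable : Σ ℕ λ N → layer (suc N) ≗ layer N
    stable with growth m
    ... | inj₁ N-stable = N-stable
    ... | inj₂ too-big  = ⊥-elim (ℕ.<⇒≱ too-big (card-≤ (layer m)))

    reach : 𝒫 m
    reach = layer (proj₁ stable)

    reach-closed : ∀ {x y} → reach y ≡ true → Arc κ y x → reach x ≡ true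
    reach-closed {x} y∈ y→x = trans (sym (proj₂ stable x)) (layer-arc (proj₁ stable) y∈ y→x)

    e∈reach : reach e ≡ true
    e∈reach = layer-mono {j = proj₁ stable} z≤n e e∈layer₀

    augmenting-or-stuck : (Σ ℕ λ k → Σ (ℕ → Fin m) λ z → z 0 ≡ e × ShortestPath κ k z) ⊎
                          (∀ x → reach x ≡ true → ¬ Free κ x)
    augmenting-or-stuck with first-free (proj₁ stable)
    ... | inj₁ (k , found , none-before) = inj₁ (k , shortest-path found none-before)
    ... | inj₂ none                      = inj₂ (λ x x∈ x-free → none (x , x∈ , x-free))

-- Counting edges against two tight covers

gate : ℕ → ℤ → ℤ
gate zero    _ = + 0
gate (suc _) z = z

gate-cases : ∀ k z → gate k z ≡ + 0 ⊎ gate k z ≡ z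
gate-cases zero    z = inj₁ refl
gate-cases (suc k) z = inj₂ refl

module Counting {n m : ℕ} (ends : Fin m → Fin n × Fin n)
                (a b : Bool → ℤ) (0≤a : ∀ d → + 0 ≤ a d) (b≥-a : ∀ d → - a d ≤ b d) where

  open Edges ends
  module M (d : Bool) = CountMatroid (a d) (b d) (0≤a d) (b≥-a d)
  open M using (capacity; TightCover)

  module _ (S : 𝒫 m) (R : Bool → 𝒫 m) (cover : ∀ d → TightCover d (R d) S)
           (sparse : ∀ W → Nonempty W → + spanned S W ≤ capacity true W + capacity false W) where

    private
      module C (d : Bool) = M.TightCover d (cover d)

      P : Fin (C.size true) → 𝒫 n
      P = C.part true

      Q : Fin (C.size false) → 𝒫 n
      Q = C.part false

    -- The parts of each cover merge into one set of capacity at most the sum; S is spanned by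
    -- the intersection of the two merged sets, to which the sparsity of S applies.
    count-bound-nonneg : + 0 ≤ b true → + 0 ≤ b false → Nonempty S →
                         + card S ≤ + card (R true) + + card (R false)
    count-bound-nonneg 0≤b₁ 0≤b₂ (x , Sx) = begin
      + card S                             ≤⟨ ℤ.+≤+ (card-mono (⊆-∩ (λ _ h → h) spans)) ⟩
      + spanned S V                        ≤⟨ sparse V (induced-nonempty (spans x Sx)) ⟩
      capacity true V + capacity false V   ≤⟨ ℤ.+-mono-≤ (bound true (∩-⊆ˡ (U true) (U false)) 0≤b₁)
                                                        (bound false (∩-⊆ʳ (U true) (U false)) 0≤b₂) ⟩
      + card (R true) + + card (R false)   ∎
      where
      open ℤ.≤-Reasoning
      U : Bool → 𝒫 n
      U d = ⋃ (C.part d)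
      V : 𝒫 n
      V = U true ∩ U false
      in-U : ∀ d y → S y ≡ true → induced (U d) y ≡ true
      in-U d y Sy = let (j , Pjy) = C.covers d y Sy in induced-mono (⊆-⋃ (C.part d) j) y Pjy
      spans : ∀ y → S y ≡ true → induced V y ≡ true
      spans y Sy = induced-∩⁺ (U true) (U false) (in-U true y Sy) (in-U false y Sy)
      bound : ∀ d → V ⊆ U d → + 0 ≤ b d → capacity d V ≤ + card (R d)
      bound d V⊆U 0≤b = begin
        capacity d V                           ≤⟨ M.capacity-mono d V⊆U ⟩
        capacity d (U d)                       ≤⟨ M.capacity-⋃ d 0≤b (C.part d) (proj₁ (C.covers d x Sx)) ⟩
        ℤΣ.sum (capacity d ∘ C.part d)         ≤⟨ M.cover-capacity d (cover d) ⟩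
        + card (R d)                           ∎

    -- A cell is charged its capacity only if it spans an edge of S.
    charge : Bool → 𝒫 n → ℤ
    charge d X = gate (spanned S X) (capacity d X)

    charge-cong : ∀ d {V W} → V ≗ W → charge d V ≡ charge d W
    charge-cong d V≗W = cong₂ gate (spanned-cong {S} (λ _ → refl) V≗W) (M.capacity-cong d V≗W)

    spanned-≤-charges : ∀ X → + spanned S X ≤ charge true X + charge false X
    spanned-≤-charges X with spanned S X in eq
    ... | zero  = ℤ.≤-refl
    ... | suc k = subst (λ s → + s ≤ capacity true X + capacity false X) eq (sparse X X≠∅)
      where
      X≠∅ : Nonempty X
      X≠∅ = let (i , SXi) = card-nonempty (subst (0 ℕ.<_) (sym eq) (s≤s z≤n)) in
            induced-nonempty (∩-⊆ʳ S (induced X) i SXi)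

    charges-≤-capacity : ∀ d → b d ≤ + 0 → ∀ {X} → Nonempty X → ∀ {q} (Y : Fin q → 𝒫 n) →
                         (∀ v → ℕΣ.sum (λ j → iverson (Y j v)) ℕ.≤ 1) →
                         ℤΣ.sum (λ j → charge d (X ∩ Y j)) ≤ capacity d X
    charges-≤-capacity d b≤0 {X} X≠∅ Y disjoint
      with M.sum-of-charges d b≤0 (λ j → card (X ∩ Y j)) (λ j → gate-cases (spanned S (X ∩ Y j)) _)
    ... | inj₁ none  = subst (_≤ capacity d X) (sym none) (M.capacity-nonneg d X≠∅)
    ... | inj₂ bound = ℤ.≤-trans bound (ℤ.+-monoˡ-≤ (b d) (M.scale-mono d (disjoint-card Y disjoint X)))

    part-nonempty : ∀ d j → Nonempty (C.part d j)
    part-nonempty d j = let (y , _ , Py) = C.meets d j in induced-nonempty Py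

    card-≤-cells : card S ℕ.≤ ℕΣ.sum (λ i → ℕΣ.sum (λ j → spanned S (P i ∩ Q j)))
    card-≤-cells = ℕ.≤-trans (card-≤-cover (induced ∘ P) (C.covers true)) (sum-mono λ i →
      ℕ.≤-trans (card-≤-cover (induced ∘ Q) (λ x h → C.covers false x (∩-⊆ˡ S (induced (P i)) x h)))
                (ℕ.≤-reflexive (ℕΣ.sum-cong-≗ (λ j → card-cong (cell i j)))))
      where
      cell : ∀ i j → (S ∩ induced (P i)) ∩ induced (Q j) ≗ S ∩ induced (P i ∩ Q j)
      cell i j x = trans (∧-assoc (S x) (induced (P i) x) (induced (Q j) x))
                         (cong (S x ∧_) (sym (induced-∩ (P i) (Q j) x)))

    charges-true : b true ≤ + 0 → ℤΣ.sum (λ i → ℤΣ.sum (λ j → charge true (P i ∩ Q j))) ≤ + card (R true)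
    charges-true b₁≤0 = begin
      ℤΣ.sum (λ i → ℤΣ.sum (λ j → charge true (P i ∩ Q j)))
        ≤⟨ ℤsum-mono (λ i → charges-≤-capacity true b₁≤0 (part-nonempty true i) Q (C.disjoint false)) ⟩
      ℤΣ.sum (capacity true ∘ P)
        ≤⟨ M.cover-capacity true (cover true) ⟩
      + card (R true) ∎
      where open ℤ.≤-Reasoning

    charges-false : b false ≤ + 0 → ℤΣ.sum (λ i → ℤΣ.sum (λ j → charge false (P i ∩ Q j))) ≤ + card (R false)
    charges-false b₂≤0 = begin
      ℤΣ.sum (λ i → ℤΣ.sum (λ j → charge false (P i ∩ Q j)))
        ≡⟨ ℤΣ.∑-comm (λ i j → charge false (P i ∩ Q j)) ⟩
      ℤΣ.sum (λ j → ℤΣ.sum (λ i → charge false (P i ∩ Q j)))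
        ≡⟨ ℤΣ.sum-cong-≗ (λ j → ℤΣ.sum-cong-≗ (λ i →
             charge-cong false (λ v → ∧-comm (P i v) (Q j v)))) ⟩
      ℤΣ.sum (λ j → ℤΣ.sum (λ i → charge false (Q j ∩ P i)))
        ≤⟨ ℤsum-mono (λ j → charges-≤-capacity false b₂≤0 (part-nonempty false j) P (C.disjoint true)) ⟩
      ℤΣ.sum (capacity false ∘ Q)
        ≤⟨ M.cover-capacity false (cover false) ⟩
      + card (R false) ∎
      where open ℤ.≤-Reasoning

    -- Each edge of S lies in a cell P i ∩ Q j; a cell spanning an edge of S is nonempty, and as b ≤ 0
    -- the cells inside one part of a cover together cost at most that part's capacity.
    count-bound-nonpos : b true ≤ + 0 → b false ≤ + 0 → + card S ≤ + card (R true) + + card (R false)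
    count-bound-nonpos b₁≤0 b₂≤0 = begin
      + card S
        ≤⟨ ℤ.+≤+ card-≤-cells ⟩
      + ℕΣ.sum (λ i → ℕΣ.sum (λ j → spanned S (P i ∩ Q j)))
        ≡⟨ as-integers ⟩
      ℤΣ.sum (λ i → ℤΣ.sum (λ j → + spanned S (P i ∩ Q j)))
        ≤⟨ ℤsum-mono (λ i → ℤsum-mono (λ j → spanned-≤-charges (P i ∩ Q j))) ⟩
      ℤΣ.sum (λ i → ℤΣ.sum (λ j → charge true (P i ∩ Q j) + charge false (P i ∩ Q j)))
        ≡⟨ split ⟩
      ℤΣ.sum (λ i → ℤΣ.sum (λ j → charge true (P i ∩ Q j))) +
      ℤΣ.sum (λ i → ℤΣ.sum (λ j → charge false (P i ∩ Q j)))
        ≤⟨ ℤ.+-mono-≤ (charges-true b₁≤0) (charges-false b₂≤0) ⟩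
      + card (R true) + + card (R false) ∎
      where
      open ℤ.≤-Reasoning
      as-integers : + ℕΣ.sum (λ i → ℕΣ.sum (λ j → spanned S (P i ∩ Q j))) ≡
                    ℤΣ.sum (λ i → ℤΣ.sum (λ j → + spanned S (P i ∩ Q j)))
      as-integers = trans (+-sum (λ i → ℕΣ.sum (λ j → spanned S (P i ∩ Q j))))
                          (ℤΣ.sum-cong-≗ (λ i → +-sum (λ j → spanned S (P i ∩ Q j))))
      split : ℤΣ.sum (λ i → ℤΣ.sum (λ j → charge true (P i ∩ Q j) + charge false (P i ∩ Q j))) ≡
              ℤΣ.sum (λ i → ℤΣ.sum (λ j → charge true (P i ∩ Q j))) +
              ℤΣ.sum (λ i → ℤΣ.sum (λ j → charge false (P i ∩ Q j)))
      split = trans (ℤΣ.sum-cong-≗ (λ i → ℤΣ.∑-distrib-+ (λ j → charge true (P i ∩ Q j))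
                                                          (λ j → charge false (P i ∩ Q j))))
                    (ℤΣ.∑-distrib-+ (λ i → ℤΣ.sum (λ j → charge true (P i ∩ Q j)))
                                    (λ i → ℤΣ.sum (λ j → charge false (P i ∩ Q j))))

-- Colouring every edge

module Decomposition {n m : ℕ} (ends : Fin m → Fin n × Fin n) (a b : Bool → ℤ) (0<a : ∀ d → + 0 < a d)
                     (signs : (∀ d → - a d ≤ b d × b d ≤ + 0) ⊎ (∀ d → + 0 ≤ b d)) where

  0≤a : ∀ d → + 0 ≤ a d
  0≤a d = ℤ.<⇒≤ (0<a d)

  b≥-a : ∀ d → - a d ≤ b d
  b≥-a d = [ (λ nonpos → proj₁ (nonpos d))
           , (λ nonneg → ℤ.≤-trans (ℤ.neg-mono-≤ (0≤a d)) (nonneg d))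
           ]′ signs

  open Edges ends
  open ExchangeGraph ends a b 0≤a b≥-a
  open Counting ends a b 0≤a b≥-a using (count-bound-nonpos; count-bound-nonneg)
  open M using (Independent; Exchange; capacity; Independent-⊆)

  capacity-sum : ∀ W → (a true + a false) * + card W + (b true + b false) ≡ capacity true W + capacity false W
  capacity-sum W = distrib (a true) (a false) (b true) (b false) (+ card W)
    where
    distrib : ∀ a₁ a₂ b₁ b₂ x → (a₁ + a₂) * x + (b₁ + b₂) ≡ a₁ * x + b₁ + (a₂ * x + b₂)
    distrib = solve-∀

  module _ (sparse : ∀ W → Nonempty W →
                     + spanned (λ _ → true) W ≤ (a true + a false) * + card W + (b true + b false)) where

    -- If no free edge is reachable from the uncoloured edge e, both colour classes restricted to the
    -- reachable set are covered by tight sets, and the counting bounds leave no room for e.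
    module Stuck {κ : Colouring} {e : Fin m} (κ-valid : Valid κ) (κe : κ e ≡ nothing) where
      open Search κ e

      R : Bool → 𝒫 m
      R d = class κ d ∩ reach

      module _ (stuck : ∀ x → reach x ≡ true → ¬ Free κ x) where

        -- The d-coloured edges of the circuit of y can all be exchanged for y, so they are reachable.
        circuit-in-reach : ∀ d {y} → reach y ≡ true → κ y ≢ just d →
          Σ (𝒫 n) λ T → M.Tight d (R d) T × induced T y ≡ true ×
                         (∀ x → class κ d x ≡ true → Exchange d (class κ d) y x → induced T x ≡ true)
        circuit-in-reach d {y} y∈ κy≢d
          with M.least-tight d (κ-valid d) (class-∉ κ y κy≢d) (λ ind → stuck y y∈ (d , κy≢d , ind))
        ... | T , T-least = T , tight-in-reach , spans ,
                            λ x x∈d y↔x → M.tight-contains-exchange d tight spans (class-∉ κ y κy≢d) x∈d y↔x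
          where
          open M.LeastTight d T-least
          tight-in-reach : M.Tight d (R d) T
          tight-in-reach = trans (cong +_ (spanned-agree T agree)) tight
            where
            agree : ∀ i → induced T i ≡ true → R d i ≡ class κ d i
            agree i Ti with class κ d i in i∈d
            ... | false = refl
            ... | true  = reach-closed y∈ (d , class⁻ κ i i∈d , κy≢d ,
                            M.exchange-within-least-tight d (κ-valid d) (class-∉ κ y κy≢d) T-least i∈d Ti)

        -- A reachable edge of colour d was reached from an edge not of colour d, whose circuit contains it.
        covered : ∀ d → M.Covered d (R d) reach
        covered d x x∈ with ≡-decₘ _≟ᵇ_ (κ x) (just d)
        ... | no κx≢d = let (T , T-tight , Tx , _) = circuit-in-reach d x∈ κx≢d in T , T-tight , Tx
        ... | yes κx≡d with layer-arrival (proj₁ stable) x∈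
        ...   | inj₁ refl with () ← trans (sym κe) κx≡d
        ...   | inj₂ (y , y∈ , d′ , κx≡d′ , κy≢d′ , y↔x) with just-injective (trans (sym κx≡d) κx≡d′)
        ...     | refl = let (T , T-tight , _ , spans-exchanged) = circuit-in-reach d y∈ κy≢d′ in
                         T , T-tight , spans-exchanged x (class⁺ κ x κx≡d) y↔x

        cover : ∀ d → M.TightCover d (R d) reach
        cover d = M.tight-cover d (Independent-⊆ d (∩-⊆ˡ (class κ d) reach) (κ-valid d)) (covered d)
        sparse-reach : ∀ W → Nonempty W → + spanned reach W ≤ capacity true W + capacity false W
        sparse-reach W W≠∅ = ℤ.≤-trans (ℤ.+≤+ (spanned-monoˡ {reach} W (λ _ _ → refl)))
                                       (subst (_ ≤_) (capacity-sum W) (sparse W W≠∅))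

        too-many : + card reach ≤ + card (R true) + + card (R false)
        too-many = [ (λ nonpos → count-bound-nonpos reach R cover sparse-reach
                                                      (proj₂ (nonpos true)) (proj₂ (nonpos false)))
                   , (λ nonneg → count-bound-nonneg reach R cover sparse-reach
                                                      (nonneg true) (nonneg false) (e , e∈reach))
                   ]′ signs

        too-few : card (R true) ℕ.+ card (R false) ℕ.< card reach
        too-few = begin-strict
          card (R true) ℕ.+ card (R false)
            ≡⟨ card-∪∩ (R true) (R false) ⟨
          card (R true ∪ R false) ℕ.+ card (R true ∩ R false)
            ≡⟨ cong (card (R true ∪ R false) ℕ.+_) (card-empty disjoint) ⟩
          card (R true ∪ R false) ℕ.+ 0
            ≡⟨ ℕ.+-identityʳ _ ⟩
          card (R true ∪ R false)
            <⟨ card-< (∪-⊆ (R⊆reach true) (R⊆reach false)) e∉R e∈reach ⟩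
          card reach ∎
          where
          open ℕ.≤-Reasoning
          R⊆reach : ∀ d → R d ⊆ reach
          R⊆reach d = ∩-⊆ʳ (class κ d) reach
          coloured : ∀ d {i} → R d i ≡ true → κ i ≡ just d
          coloured d {i} h = class⁻ κ i (∩-⊆ˡ (class κ d) reach i h)
          disjoint : ¬ Nonempty (R true ∩ R false)
          disjoint (i , i∈both) with () ← trans (sym (coloured true (∩-⊆ˡ (R true) (R false) i i∈both)))
                                               (coloured false (∩-⊆ʳ (R true) (R false) i i∈both))
          e∉class : ∀ d → class κ d e ≡ false
          e∉class d = class-∉ κ e (λ eq → case trans (sym κe) eq of λ ())
          e∉R : (R true ∪ R false) e ≡ false
          e∉R = cong₂ (λ p q → p ∧ reach e ∨ q ∧ reach e) (e∉class true) (e∉class false)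

        impossible : ⊥
        impossible = ℤ.<⇒≱ (subst (_< + card reach) (ℤ.pos-+ (card (R true)) (card (R false))) (ℤ.+<+ too-few))
                           too-many

    colour-all : ∀ {κ} → Valid κ → Σ Colouring λ κ′ → Valid κ′ × (∀ x → κ′ x ≢ nothing)
    colour-all {κ} κ-valid = go {κ} κ-valid (<-wellFounded _)
      where
      go : ∀ {κ} → Valid κ → Acc ℕ._<_ (card (uncoloured κ)) →
           Σ Colouring λ κ′ → Valid κ′ × (∀ x → κ′ x ≢ nothing)
      go {κ} κ-valid (acc smaller) with any? (λ x → ≡-decₘ _≟ᵇ_ (κ x) nothing)
      ... | no none = κ , κ-valid , λ x κx → none (x , κx)
      ... | yes (e , κe) with Search.augmenting-or-stuck κ e
      ...   | inj₂ stuck = ⊥-elim (Stuck.impossible {κ} {e} κ-valid κe stuck)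
      ...   | inj₁ (k , z , refl , path) with augment k κ-valid path
      ...     | κ′ , κ′-valid , coloured , still = go {κ′} κ′-valid (smaller fewer)
        where
        fewer : card (uncoloured κ′) ℕ.< card (uncoloured κ)
        fewer = card-< (λ i h → uncoloured⁺ κ (still i (uncoloured⁻ κ′ i h)))
                       (uncoloured-∉ κ′ (z 0) coloured) (uncoloured⁺ κ κe)

    decomposition : Σ (Fin m → Bool) λ c → ∀ d → Independent d (λ i → does (c i ≟ᵇ d))
    decomposition with colour-all {λ _ → nothing} (λ d → M.Independent-∅ d)
    ... | κ , κ-valid , total = class κ true , λ d → M.Independent-cong d (classes d) (κ-valid d)
      where
      classes : ∀ d i → class κ d i ≡ does (class κ true i ≟ᵇ d)
      classes d i with κ i | total i
      ... | just true  | _           = refl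
      ... | just false | _           = refl
      ... | nothing    | κi≢nothing = ⊥-elim (κi≢nothing refl)

-- Graphs, subgraphs and colour classes

∣lookup∣ : ∀ {k} (v : Subset.Subset k) → Subset.∣ v ∣ ≡ card (lookup v)
∣lookup∣ []          = refl
∣lookup∣ (true ∷ v)  = cong suc (∣lookup∣ v)
∣lookup∣ (false ∷ v) = ∣lookup∣ v

∣tabulate∣ : ∀ {k} (W : 𝒫 k) → Subset.∣ tabulate W ∣ ≡ card W
∣tabulate∣ W = trans (∣lookup∣ (tabulate W)) (card-cong (lookup∘tabulate W))

module _ {n : ℕ} where

  colourClass-spanned : ∀ (E : List (Edge n)) c β (V : Subset.Subset n)
    (D : Subset.Subset (length (colourClass E c β))) →
    (∀ j → j Subset.∈ D → proj₁ (entry (colourClass E c β) j) Subset.∈ V ×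
                         proj₂ (entry (colourClass E c β) j) Subset.∈ V) →
    Subset.∣ D ∣ ℕ.≤ Edges.spanned (entry E) (λ i → does (c i ≟ᵇ β)) (lookup V)
  colourClass-spanned []      c β V [] inside = z≤n
  colourClass-spanned (e ∷ E) c β V D inside with c zero ≟ᵇ β
  colourClass-spanned (e ∷ E) c β V (true ∷ D) inside | yes _
    rewrite []=⇒lookup (proj₁ (inside zero here)) | []=⇒lookup (proj₂ (inside zero here)) =
    s≤s (colourClass-spanned E (c ∘ suc) β V D (λ j j∈D → inside (suc j) (there j∈D)))
  colourClass-spanned (e ∷ E) c β V (false ∷ D) inside | yes _ =
    ℕ.≤-trans (colourClass-spanned E (c ∘ suc) β V D (λ j j∈D → inside (suc j) (there j∈D)))
              (ℕ.m≤n+m _ _)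
  colourClass-spanned (e ∷ E) c β V D inside | no _ =
    colourClass-spanned E (c ∘ suc) β V D inside

module _ {n : ℕ} (G : Graph n) {a b : ℤ} where

  open Edges (entry (edges G))

  sparse-spanned : Sparse a b G → ∀ W → Nonempty W → + spanned (λ _ → true) W ≤ a * + card W + b
  sparse-spanned sparse W (v , Wv) =
    subst₂ (λ e k → + e ≤ a * + k + b) (∣tabulate∣ (induced W)) (∣tabulate∣ W)
           (sparse H (v , ∈tabulate v Wv))
    where
    ∈tabulate : ∀ u → W u ≡ true → u Subset.∈ tabulate W
    ∈tabulate u Wu = lookup⇒[]= u (tabulate W) (trans (lookup∘tabulate W u) Wu)
    endpoints : ∀ i → i Subset.∈ tabulate (induced W) →
                proj₁ (entry (edges G) i) Subset.∈ tabulate W × proj₂ (entry (edges G) i) Subset.∈ tabulate W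
    endpoints i i∈ with W (proj₁ (entry (edges G) i)) in W₁ | W (proj₂ (entry (edges G) i)) in W₂
                   | trans (sym (lookup∘tabulate (induced W) i)) ([]=⇒lookup i∈)
    ... | true | true | _ = ∈tabulate _ W₁ , ∈tabulate _ W₂
    H : Subgraph (edges G)
    H = record { verts = tabulate W ; edgeSet = tabulate (induced W) ; closed = endpoints }

  module _ {0≤a : + 0 ≤ a} {b≥-a : - a ≤ b} where

    open CountMatroid a b 0≤a b≥-a

    colourClass-sparse : ∀ c β → Independent (λ i → does (c i ≟ᵇ β)) →
                         SparseEdges a b (colourClass (edges G) c β)
    colourClass-sparse c β β-independent H (v , v∈) =
      subst (λ k → + eH H ≤ a * + k + b) (sym (∣lookup∣ (verts H)))
        (ℤ.≤-trans (ℤ.+≤+ (colourClass-spanned (edges G) c β (verts H) (edgeSet H) (closed H)))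
                   (bounded β-independent (lookup (verts H)) (v , []=⇒lookup v∈)))

theorem1 : (a₁ a₂ b₁ b₂ : ℤ) → + 0 < a₁ → + 0 < a₂ →
    ((- a₁ ≤ b₁ × b₁ ≤ + 0) × (- a₂ ≤ b₂ × b₂ ≤ + 0)) ⊎ (+ 0 ≤ b₁ × + 0 ≤ b₂) →
    {n : ℕ} (G : Graph n) → Sparse (a₁ + a₂) (b₁ + b₂) G →
    Σ (Fin (length (edges G)) → Bool) (λ c →
      SparseEdges a₁ b₁ (colourClass (edges G) c true) ×
      SparseEdges a₂ b₂ (colourClass (edges G) c false))
theorem1 a₁ a₂ b₁ b₂ 0<a₁ 0<a₂ signs G sparse =
  let (c , independent) = Decomposition.decomposition (entry (edges G)) a b 0<a signs′
                            (sparse-spanned G {a₁ + a₂} {b₁ + b₂} sparse)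
  in c , colourClass-sparse G c true (independent true) , colourClass-sparse G c false (independent false)
  where
  a b : Bool → ℤ
  a d = if d then a₁ else a₂
  b d = if d then b₁ else b₂
  0<a : ∀ d → + 0 < a d
  0<a true  = 0<a₁
  0<a false = 0<a₂
  signs′ : (∀ d → - a d ≤ b d × b d ≤ + 0) ⊎ (∀ d → + 0 ≤ b d)
  signs′ = Sum.map (λ (A₁ , A₂) → λ { true → A₁ ; false → A₂ })
                   (λ (B₁ , B₂) → λ { true → B₁ ; false → B₂ }) signs
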